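{- Let $\lambda$ be a partition, $i\in\mathbb{Z}$ and $j\ge1$ an integer. (a) If $\lambda$ has an $i$-addable ribbon of spin $s$, then $\left(\sum_{k=i+1}^{\infty}h_k^{(j)}\right)\lambda=-(1+q^{2j}+\cdots+q^{2(s-1)j})\lambda$. (b) If $\lambda$ has an $i$-removable ribbon of spin $s$, then $\left(\sum_{k=i+1}^{\infty}h_k^{(j)}\right)\lambda=-(1+q^{2j}+\cdots+q^{2sj})\lambda$. (c) If $i$ is so small that no $n$-ribbon can be added to $\lambda$ with head on a diagonal less than $i$, then $\left(\sum_{k=i}^{\infty}h_k^{(j)}\right)\lambda=-(1+q^{2j}+\cdots+q^{2(n-1)j})\lambda$.
   Context: Fix an integer $n\ge 1$. Partitions are drawn in English notation; the box in row $r$ and column $c$ lies on diagonal $c-r$. An $n$-ribbon is a connected skew shape with $n$ boxes containing no $2\times 2$ square; its head is its top-right box, and its spin is its number of rows minus $1$. A partition $\lambda$ has an $i$-addable ribbon (of spin $s$) if there is a partition $\mu$ with $\mu/\lambda$ an $n$-ribbon with head on diagonal $i$ (and spin $s$); it has an $i$-removable ribbon (of spin $s$) if there is a partition $\nu$ with $\lambda/\nu$ an $n$-ribbon with head on diagonal $i$ (and spin $s$). Let $K=\mathbb{C}(q)$ and let $\mathbf F$ be the $K$-vector space with basis the set of all partitions. Let $u_i,d_i\in\mathrm{End}_K(\mathbf F)$ be defined by $u_i(\lambda)=q^{\mathrm{spin}(\mu/\lambda)}\mu$ if $\lambda$ has an $i$-addable ribbon $\mu/\lambda$, else $0$, and $d_i(\lambda)=q^{\mathrm{spin}(\lambda/\nu)}\nu$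 if $\lambda$ has an $i$-removable ribbon $\lambda/\nu$, else $0$. For $i\in\mathbb{Z}$, $j\ge1$ define $h_i^{(j)}=(u_id_i)^j-(d_iu_i)^j$; it acts diagonally: $h_i^{(j)}\lambda=-q^{2j\,\mathrm{spin}(\mu/\lambda)}\lambda$ if $\lambda$ has an $i$-addable ribbon $\mu/\lambda$, $h_i^{(j)}\lambda=q^{2j\,\mathrm{spin}(\lambda/\nu)}\lambda$ if $\lambda$ has an $i$-removable ribbon $\lambda/\nu$, and $0$ otherwise. Infinite sums of the $h_k^{(j)}$ are well defined since only finitely many act nontrivially on a given partition. An empty sum $1+q^{2j}+\cdots+q^{2(s-1)j}$ with $s=0$ is $0$. -}

module Defs where

open import Data.Nat as ℕ using (ℕ; zero; suc; _≤_; _<_; _*_)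
open import Data.Integer as ℤ using (ℤ; +_)
open import Data.List using (List; []; _∷_; length)
open import Data.Nat.ListAction using (sum)
open import Data.Bool using (true; false)
open import Data.List.Relation.Unary.All using (All)
open import Data.List.Relation.Unary.Linked using (Linked)
open import Data.Product using (Σ; ∃; ∃-syntax; _×_; _,_; proj₁; proj₂)
open import Data.Sum using (_⊎_)
open import Relation.Nullary using (¬_)
open import Relation.Binary.PropositionalEquality using (_≡_)
open import Relation.Binary.Construct.Closure.ReflexiveTransitive using (Star)
open import Relation.Nullary.Decidable using (does)

-- Partitions: weakly decreasing lists of positive integers (English
-- notation; rows and columns are 0-indexed, which does not change
-- diagonals c - r).

record Partition : Set where
  constructor mkPartition
  field
    parts      : List ℕ
    decreasing : Linked ℕ._≥_ parts
    positive   : All (0 <_) parts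
open Partition public

partAt : List ℕ → ℕ → ℕ
partAt []       _       = 0
partAt (x ∷ _)  zero    = x
partAt (_ ∷ xs) (suc r) = partAt xs r

row : Partition → ℕ → ℕ
row λ' r = partAt (parts λ') r

size : Partition → ℕ
size λ' = sum (parts λ')

-- Boxes: (row , column)
Box : Set
Box = ℕ × ℕ

diag : Box → ℤ
diag b = (+ proj₂ b) ℤ.- (+ proj₁ b)

InSkew : Partition → Partition → Box → Set
InSkew μ λ' b = row λ' (proj₁ b) ≤ proj₂ b × proj₂ b < row μ (proj₁ b)

Adj : Box → Box → Set
Adj a b =
  (proj₁ a ≡ proj₁ b × (suc (proj₂ a) ≡ proj₂ b ⊎ proj₂ a ≡ suc (proj₂ b)))
  ⊎ (proj₂ a ≡ proj₂ b × (suc (proj₁ a) ≡ proj₁ b ⊎ proj₁ a ≡ suc (proj₁ b)))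

SkewAdj : Partition → Partition → Box → Box → Set
SkewAdj μ λ' a b = InSkew μ λ' a × InSkew μ λ' b × Adj a b

Connected : Partition → Partition → Set
Connected μ λ' = ∀ a b → InSkew μ λ' a → InSkew μ λ' b → Star (SkewAdj μ λ') a b

No2x2 : Partition → Partition → Set
No2x2 μ λ' = ∀ r c → ¬ (InSkew μ λ' (r , c) × InSkew μ λ' (r , suc c)
                        × InSkew μ λ' (suc r , c) × InSkew μ λ' (suc r , suc c))

_⊆ₚ_ : Partition → Partition → Set
λ' ⊆ₚ μ = ∀ r → row λ' r ≤ row μ r

IsRibbon : ℕ → Partition → Partition → Set
IsRibbon n μ λ' = λ' ⊆ₚ μ × size μ ≡ size λ' ℕ.+ n × Connected μ λ' × No2x2 μ λ'

IsHead : Partition → Partition → Box → Set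
IsHead μ λ' b = InSkew μ λ' b ×
  (∀ b' → InSkew μ λ' b' → proj₁ b < proj₁ b' ⊎ (proj₁ b ≡ proj₁ b' × proj₂ b' ≤ proj₂ b))

rowsBelow : Partition → Partition → ℕ → ℕ
rowsBelow μ λ' zero    = 0
rowsBelow μ λ' (suc m) with does (row λ' m ℕ.<? row μ m)
... | true  = suc (rowsBelow μ λ' m)
... | false = rowsBelow μ λ' m

-- number of rows of the skew shape μ / λ (rows beyond the length of μ are empty)
numRows : Partition → Partition → ℕ
numRows μ λ' = rowsBelow μ λ' (length (parts μ))

AddRibbon : ℕ → Partition → Partition → ℤ → ℕ → Set
AddRibbon n λ' μ i s =
  IsRibbon n μ λ' × (∃[ b ] (IsHead μ λ' b × diag b ≡ i)) × numRows μ λ' ≡ suc s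

RemRibbon : ℕ → Partition → Partition → ℤ → ℕ → Set
RemRibbon n λ' ν i s =
  IsRibbon n λ' ν × (∃[ b ] (IsHead λ' ν b × diag b ≡ i)) × numRows λ' ν ≡ suc s

-- Scalars: polynomials in q with integer coefficients (a subring of
-- K = ℂ(q)), represented by their coefficient functions; equality is
-- coefficientwise.

Poly : Set
Poly = ℕ → ℤ

_≈_ : Poly → Poly → Set
f ≈ g = ∀ m → f m ≡ g m

0ₚ : Poly
0ₚ _ = + 0

_+ₚ_ : Poly → Poly → Poly
(f +ₚ g) m = f m ℤ.+ g m

-ₚ_ : Poly → Poly
(-ₚ f) m = ℤ.- f m

qpow : ℕ → Poly
qpow e m with does (e ℕ.≟ m)
... | true  = + 1
... | false = + 0

geom : ℕ → ℕ → Poly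
geom j zero    = 0ₚ
geom j (suc s) = geom j s +ₚ qpow (2 * s * j)

-- The diagonal action of h_k^{(j)}: "h_k^{(j)} λ = e · λ", as given by the
-- diagonal formula in the context.

HActs : ℕ → ℕ → ℤ → Partition → Poly → Set
HActs n j k λ' e =
  (∀ μ s → AddRibbon n λ' μ k s → e ≈ (-ₚ qpow (2 * j * s)))
  × (∀ ν s → RemRibbon n λ' ν k s → e ≈ qpow (2 * j * s))
  × ((∀ μ s → ¬ AddRibbon n λ' μ k s) → (∀ ν s → ¬ RemRibbon n λ' ν k s) → e ≈ 0ₚ)

sumFrom : ℤ → ℕ → (ℤ → Poly) → Poly
sumFrom a zero    e = 0ₚ
sumFrom a (suc m) e = e a +ₚ sumFrom (ℤ.suc a) m e

-- (Σ_{k ≥ a} h_k^{(j)}) λ = c · λ : for the eigenvalues e k of h_k^{(j)} on λ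
-- (k ≥ a), the partial sums are eventually equal to c (only finitely many
-- terms are nonzero, so this is the value of the infinite sum).
SumActs : ℕ → ℕ → ℤ → Partition → Poly → Set
SumActs n j a λ' c =
  ∀ (e : ℤ → Poly) → (∀ k → a ℤ.≤ k → HActs n j k λ' (e k)) →
  ∃[ N ] (∀ m → N ≤ m → sumFrom a m e ≈ c)

-- Record λ' on the abacus by its beta numbers β r = λ'_r - r, a strictly decreasing
-- sequence containing every integer ≤ - length λ'. Adding an n-ribbon with head on
-- diagonal k moves a bead from k + 1 - n up to the gap at k + 1, and its spin is the
-- number of beads jumped over; removing one moves a bead from k + 1 down to a gap at
-- k + 1 - n. So if W k is the number of beads at positions k + 1 - n, …, k, then
-- h_k^{(j)} acts on λ' by geom (W (k + 1)) - geom (W k), where geom w = 1 + q^{2j} + ⋯ + q^{2(w-1)j}.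
-- The sum over k ≥ a telescopes to - geom (W a), since the window is eventually empty.
-- Finally W (i + 1) is s in (a) and s + 1 in (b), and W i = n in (c): there every
-- position ≤ i holds a bead, since a gap at y ≤ i above a bead at y - n would give an
-- addable ribbon with head on diagonal y - 1 < i.

module Submission where

open import Defs
open import Data.Bool using (true; false)
open import Data.Empty using (⊥; ⊥-elim)
open import Data.Integer as ℤ using (ℤ; +_; -[1+_]; 1ℤ)
import Data.Integer.Properties as ℤP
open import Data.Integer.Tactic.RingSolver using (solve-∀)
open import Data.List using (List; []; _∷_; length)
open import Data.List.Relation.Unary.All using (All; []; _∷_)
open import Data.List.Relation.Unary.Linked using (Linked; []; [-]; _∷_)
open import Data.Nat as ℕ using (ℕ; zero; suc; z≤n; s≤s)
open import Data.Nat.ListAction using (sum)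
import Data.Nat.Properties as ℕP
import Data.Nat.Tactic.RingSolver as ℕ-Solver
open import Data.Product using (∃; ∃-syntax; _×_; _,_; proj₁; proj₂)
open import Data.Sum using (_⊎_; inj₁; inj₂)
open import Relation.Binary.Construct.Closure.ReflexiveTransitive using (Star; ε; _◅_; _◅◅_; reverse)
open import Relation.Binary.Definitions using (tri<; tri≈; tri>)
open import Relation.Binary.PropositionalEquality
open import Relation.Nullary using (¬_; Dec; yes; no)

i≤+∣i∣ : ∀ i → i ℤ.≤ + ℤ.∣ i ∣
i≤+∣i∣ (+ _)     = ℤP.≤-refl
i≤+∣i∣ -[1+ _ ] = ℤ.-≤+

i<suc[i] : ∀ i → i ℤ.< ℤ.suc i
i<suc[i] i = ℤP.suc[i]≤j⇒i<j ℤP.≤-refl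

<suc⇒≤ : ∀ {i j} → i ℤ.< ℤ.suc j → i ℤ.≤ j
<suc⇒≤ {i} {j} p = subst (i ℤ.≤_) (ℤP.pred-suc j) (ℤP.i<j⇒i≤pred[j] p)

minus-plus : ∀ i j → i ℤ.- j ℤ.+ j ≡ i
minus-plus = solve-∀

plus-minus : ∀ i j → i ℤ.+ j ℤ.- j ≡ i
plus-minus = solve-∀

suc-minus : ∀ y n → ℤ.suc y ℤ.- + n ≡ ℤ.suc (y ℤ.- + n)
suc-minus y n = ℤP.+-assoc 1ℤ y (ℤ.- + n)

sum-eq⇒diff-eq : ∀ n a b r0 r1 → n ℕ.+ a ℕ.+ r0 ≡ b ℕ.+ r1 → + a ℤ.- + r1 ≡ (+ b ℤ.- + r0) ℤ.- + n
sum-eq⇒diff-eq n a b r0 r1 eq = begin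
  + a ℤ.- + r1                                      ≡⟨ expand (+ n) (+ a) (+ r0) (+ r1) ⟩
  + (n ℕ.+ a ℕ.+ r0) ℤ.- + r1 ℤ.- + r0 ℤ.- + n      ≡⟨ cong (λ z → + z ℤ.- + r1 ℤ.- + r0 ℤ.- + n) eq ⟩
  + (b ℕ.+ r1) ℤ.- + r1 ℤ.- + r0 ℤ.- + n            ≡⟨ contract (+ n) (+ b) (+ r0) (+ r1) ⟩
  (+ b ℤ.- + r0) ℤ.- + n                            ∎
  where
  open ≡-Reasoning
  expand : ∀ n a r0 r1 → a ℤ.- r1 ≡ (n ℤ.+ a ℤ.+ r0) ℤ.- r1 ℤ.- r0 ℤ.- n
  expand = solve-∀
  contract : ∀ n b r0 r1 → (b ℤ.+ r1) ℤ.- r1 ℤ.- r0 ℤ.- n ≡ (b ℤ.- r0) ℤ.- n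
  contract = solve-∀

diff-eq⇒sum-eq : ∀ n a b r0 r1 → + a ℤ.- + r1 ≡ (+ b ℤ.- + r0) ℤ.- + n → n ℕ.+ a ℕ.+ r0 ≡ b ℕ.+ r1
diff-eq⇒sum-eq n a b r0 r1 eq = ℤP.+-injective (begin
  + n ℤ.+ + a ℤ.+ + r0                              ≡⟨ expand (+ n) (+ a) (+ r0) (+ r1) ⟩
  (+ a ℤ.- + r1) ℤ.+ + n ℤ.+ + r0 ℤ.+ + r1          ≡⟨ cong (λ z → z ℤ.+ + n ℤ.+ + r0 ℤ.+ + r1) eq ⟩
  ((+ b ℤ.- + r0) ℤ.- + n) ℤ.+ + n ℤ.+ + r0 ℤ.+ + r1 ≡⟨ contract (+ n) (+ b) (+ r0) (+ r1) ⟩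
  + b ℤ.+ + r1                                      ∎)
  where
  open ≡-Reasoning
  expand : ∀ n a r0 r1 → n ℤ.+ a ℤ.+ r0 ≡ (a ℤ.- r1) ℤ.+ n ℤ.+ r0 ℤ.+ r1
  expand = solve-∀
  contract : ∀ n b r0 r1 → ((b ℤ.- r0) ℤ.- n) ℤ.+ n ℤ.+ r0 ℤ.+ r1 ≡ b ℤ.+ r1
  contract = solve-∀

ℤsuc-injective : ∀ {i j} → ℤ.suc i ≡ ℤ.suc j → i ≡ j
ℤsuc-injective {i} {j} eq = trans (sym (ℤP.pred-suc i)) (trans (cong ℤ.pred eq) (ℤP.pred-suc j))

i-n<i : ∀ i n → 1 ℕ.≤ n → i ℤ.- + n ℤ.< i
i-n<i i (suc n) _ = subst (i ℤ.+ -[1+ n ] ℤ.<_) (ℤP.+-identityʳ i) (ℤP.+-monoʳ-< i ℤ.-<+)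

-- Rows and beta numbers

Decreasing : (ℕ → ℕ) → Set
Decreasing f = ∀ r → f (suc r) ℕ.≤ f r

stepwise-antitone : {f : ℕ → ℕ} → Decreasing f → ∀ {r r′} → r ℕ.≤ r′ → f r′ ℕ.≤ f r
stepwise-antitone f↓ {r′ = zero} z≤n = ℕP.≤-refl
stepwise-antitone f↓ {r} {suc r′} r≤ with ℕP.m≤n⇒m<n∨m≡n r≤
... | inj₁ r<sr′ = ℕP.≤-trans (f↓ r′) (stepwise-antitone f↓ (ℕP.≤-pred r<sr′))
... | inj₂ refl  = ℕP.≤-refl

partAt-suc≤ : ∀ {xs} → Linked ℕ._≥_ xs → ∀ r → partAt xs (suc r) ℕ.≤ partAt xs r
partAt-suc≤ []       r       = z≤n
partAt-suc≤ [-]      r       = z≤n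
partAt-suc≤ (x≥y ∷ _) zero    = x≥y
partAt-suc≤ (_ ∷ xs) (suc r) = partAt-suc≤ xs r

partAt-beyond : ∀ xs r → length xs ℕ.≤ r → partAt xs r ≡ 0
partAt-beyond []       r       _       = refl
partAt-beyond (x ∷ xs) (suc r) (s≤s p) = partAt-beyond xs r p

partAt-nonzero⇒< : ∀ xs r → 0 ℕ.< partAt xs r → r ℕ.< length xs
partAt-nonzero⇒< (x ∷ xs) zero    _ = s≤s z≤n
partAt-nonzero⇒< (x ∷ xs) (suc r) p = s≤s (partAt-nonzero⇒< xs r p)

row-suc≤ : ∀ λ' → Decreasing (row λ')
row-suc≤ λ' = partAt-suc≤ (decreasing λ')

row-antitone : ∀ λ' {r r′} → r ℕ.≤ r′ → row λ' r′ ℕ.≤ row λ' r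
row-antitone λ' = stepwise-antitone (row-suc≤ λ')

rows-vanish-beyond : ∀ λ' r1 → row λ' (suc r1 ℕ.+ length (parts λ')) ≡ 0
rows-vanish-beyond λ' r1 = partAt-beyond (parts λ') _ (ℕP.m≤n+m _ (suc r1))

β : Partition → ℕ → ℤ
β λ' r = + row λ' r ℤ.- + r

β-antitone : ∀ λ' {r r′} → r ℕ.≤ r′ → β λ' r′ ℤ.≤ β λ' r
β-antitone λ' r≤r′ = ℤP.+-mono-≤ (ℤ.+≤+ (row-antitone λ' r≤r′)) (ℤP.neg-mono-≤ (ℤ.+≤+ r≤r′))

β-suc< : ∀ λ' r → β λ' (suc r) ℤ.< β λ' r
β-suc< λ' r = ℤP.+-mono-≤-< (ℤ.+≤+ (row-suc≤ λ' r)) (ℤP.neg-mono-< (ℤ.+<+ (ℕP.n<1+n r)))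

β-strictlyAntitone : ∀ λ' {r r′} → r ℕ.< r′ → β λ' r′ ℤ.< β λ' r
β-strictlyAntitone λ' {r′ = suc r′} (s≤s r≤r′) = ℤP.<-≤-trans (β-suc< λ' r′) (β-antitone λ' r≤r′)

β<⇒row< : ∀ λ' r {y} → β λ' r ℤ.< y → + row λ' r ℤ.< y ℤ.+ + r
β<⇒row< λ' r {y} β<y = subst (ℤ._< y ℤ.+ + r) (minus-plus (+ row λ' r) (+ r)) (ℤP.+-monoˡ-< (+ r) β<y)

≤β⇒≤row : ∀ λ' r {y} → y ℤ.≤ β λ' r → y ℤ.+ + r ℤ.≤ + row λ' r
≤β⇒≤row λ' r {y} y≤β = subst (y ℤ.+ + r ℤ.≤_) (minus-plus (+ row λ' r) (+ r)) (ℤP.+-monoˡ-≤ (+ r) y≤β)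

-- The abacus

Least : (ℕ → Set) → ℕ → Set
Least P m = P m × (∀ t → t ℕ.< m → ¬ P t)

module _ {P : ℕ → Set} (P? : ∀ t → Dec (P t)) where

  private
    search : ∀ fuel r → (∀ t → t ℕ.< r → ¬ P t) → P (r ℕ.+ fuel) → ∃ (Least P)
    search zero r none p = r , subst P (ℕP.+-identityʳ r) p , none
    search (suc fuel) r none p with P? r
    ... | yes pr = r , pr , none
    ... | no ¬pr = search fuel (suc r) none′ (subst P (ℕP.+-suc r fuel) p)
      where
      none′ : ∀ t → t ℕ.< suc r → ¬ P t
      none′ t t<sr with ℕP.m≤n⇒m<n∨m≡n (ℕP.≤-pred t<sr)
      ... | inj₁ t<r  = none t t<r
      ... | inj₂ refl = ¬pr

  least : ∀ F → P F → ∃ (Least P)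
  least F = search F 0 (λ _ ())

β-eventually< : ∀ λ' y → β λ' (suc (row λ' 0 ℕ.+ ℤ.∣ y ∣)) ℤ.< y
β-eventually< λ' y = ℤP.≤-<-trans βF≤ (subst (ℤ._< y) (sym row0-F≡) (-[1+∣i∣]<i y))
  where
  F : ℕ
  F = suc (row λ' 0 ℕ.+ ℤ.∣ y ∣)
  βF≤ : β λ' F ℤ.≤ + row λ' 0 ℤ.- + F
  βF≤ = ℤP.+-monoˡ-≤ (ℤ.- + F) (ℤ.+≤+ (row-antitone λ' z≤n))
  row0-F≡ : + row λ' 0 ℤ.- + F ≡ -[1+ ℤ.∣ y ∣ ]
  row0-F≡ = a-[1+a+b]≡-[1+b] (+ row λ' 0) (+ ℤ.∣ y ∣)
    where
    a-[1+a+b]≡-[1+b] : ∀ a b → a ℤ.- (1ℤ ℤ.+ (a ℤ.+ b)) ≡ ℤ.- (1ℤ ℤ.+ b)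
    a-[1+a+b]≡-[1+b] = solve-∀
  -[1+∣i∣]<i : ∀ i → -[1+ ℤ.∣ i ∣ ] ℤ.< i
  -[1+∣i∣]<i (+ _)     = ℤ.-<+
  -[1+∣i∣]<i -[1+ _ ] = ℤ.-<- ℕP.≤-refl

firstBeadBelow : ∀ λ' y → ∃ (Least (λ t → β λ' t ℤ.< y))
firstBeadBelow λ' y = least (λ t → β λ' t ℤ.<? y) (suc (row λ' 0 ℕ.+ ℤ.∣ y ∣)) (β-eventually< λ' y)

-- beadsFrom λ' y is the number of beads at positions ≥ y. It is kept abstract
-- because unfolding the search makes type checking very slow.
abstract
  beadsFrom : Partition → ℤ → ℕ
  beadsFrom λ' y = proj₁ (firstBeadBelow λ' y)

  β-beadsFrom< : ∀ λ' y → β λ' (beadsFrom λ' y) ℤ.< y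
  β-beadsFrom< λ' y = proj₁ (proj₂ (firstBeadBelow λ' y))

  ≤β-beforeBeadsFrom : ∀ λ' y t → t ℕ.< beadsFrom λ' y → y ℤ.≤ β λ' t
  ≤β-beforeBeadsFrom λ' y t t< = ℤP.≮⇒≥ (proj₂ (proj₂ (firstBeadBelow λ' y)) t t<)

beadsFrom-unique : ∀ λ' y m → (∀ t → t ℕ.< m → y ℤ.≤ β λ' t) → β λ' m ℤ.< y → beadsFrom λ' y ≡ m
beadsFrom-unique λ' y m before at with ℕP.<-cmp (beadsFrom λ' y) m
... | tri< lt _ _ = ⊥-elim (ℤP.<⇒≱ (β-beadsFrom< λ' y) (before _ lt))
... | tri≈ _ eq _ = eq
... | tri> _ _ gt = ⊥-elim (ℤP.<⇒≱ at (≤β-beforeBeadsFrom λ' y m gt))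

beadsFrom-unique-suc : ∀ λ' y r → y ℤ.≤ β λ' r → β λ' (suc r) ℤ.< y → beadsFrom λ' y ≡ suc r
beadsFrom-unique-suc λ' y r y≤ <y =
  beadsFrom-unique λ' y (suc r) (λ t t<sr → ℤP.≤-trans y≤ (β-antitone λ' (ℕP.≤-pred t<sr))) <y

beadsFrom-antitone : ∀ λ' {y y′} → y ℤ.≤ y′ → beadsFrom λ' y′ ℕ.≤ beadsFrom λ' y
beadsFrom-antitone λ' {y} {y′} y≤y′ = ℕP.≮⇒≥ λ lt →
  ℤP.<⇒≱ (ℤP.<-≤-trans (β-beadsFrom< λ' y) y≤y′) (≤β-beforeBeadsFrom λ' y′ _ lt)

Gap Bead : Partition → ℤ → Set
Gap  λ' y = beadsFrom λ' y ≡ beadsFrom λ' (ℤ.suc y)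
Bead λ' y = beadsFrom λ' y ≡ suc (beadsFrom λ' (ℤ.suc y))

gap⊎bead : ∀ λ' y → Gap λ' y ⊎ Bead λ' y
gap⊎bead λ' y with ℤP.<-cmp (β λ' m) y
  where
  m : ℕ
  m = beadsFrom λ' (ℤ.suc y)
... | tri< lt _ _ = inj₁ (beadsFrom-unique λ' y _
        (λ t t<m → ℤP.≤-trans (ℤP.i≤suc[i] y) (≤β-beforeBeadsFrom λ' (ℤ.suc y) t t<m)) lt)
... | tri≈ _ eq _ = inj₂ (beadsFrom-unique-suc λ' y _ (ℤP.≤-reflexive (sym eq))
        (subst (β λ' (suc (beadsFrom λ' (ℤ.suc y))) ℤ.<_) eq (β-suc< λ' _)))
... | tri> _ _ gt = ⊥-elim (ℤP.<⇒≱ (β-beadsFrom< λ' (ℤ.suc y)) (ℤP.i<j⇒suc[i]≤j gt))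

gap-bead-exclusive : ∀ {λ' y} → Gap λ' y → Bead λ' y → ⊥
gap-bead-exclusive gap bead = ℕP.1+n≢n (trans (sym bead) gap)

beadsFrom-atBead : ∀ λ' r y → β λ' r ≡ y → beadsFrom λ' (ℤ.suc y) ≡ r × beadsFrom λ' y ≡ suc r
beadsFrom-atBead λ' r y refl =
  beadsFrom-unique λ' _ r (λ t t<r → ℤP.i<j⇒suc[i]≤j (β-strictlyAntitone λ' t<r)) (i<suc[i] _) ,
  beadsFrom-unique-suc λ' _ r ℤP.≤-refl (β-suc< λ' r)

bead-atβ : ∀ λ' r y → β λ' r ≡ y → Bead λ' y
bead-atβ λ' r y eq with beadsFrom-atBead λ' r y eq
... | from-suc-y , from-y = trans from-y (cong suc (sym from-suc-y))

bead⇒β : ∀ {λ' y} → Bead λ' y → β λ' (beadsFrom λ' (ℤ.suc y)) ≡ y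
bead⇒β {λ'} {y} bead = ℤP.≤-antisym (<suc⇒≤ (β-beadsFrom< λ' (ℤ.suc y)))
  (≤β-beforeBeadsFrom λ' y m (subst (m ℕ.<_) (sym bead) (ℕP.n<1+n m)))
  where
  m : ℕ
  m = beadsFrom λ' (ℤ.suc y)

gap⇒β< : ∀ {λ' y} → Gap λ' y → β λ' (beadsFrom λ' (ℤ.suc y)) ℤ.< y
gap⇒β< {λ'} {y} gap = subst (λ r → β λ' r ℤ.< y) gap (β-beadsFrom< λ' y)

-- The number of beads at the n positions y - n, …, y - 1.
beadsIn : Partition → ℕ → ℤ → ℕ
beadsIn λ' n y = beadsFrom λ' (y ℤ.- + n) ℕ.∸ beadsFrom λ' y

module _ (λ' : Partition) (n : ℕ) (y : ℤ) where

  private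
    from : ℤ → ℕ
    from = beadsFrom λ'

    from-suc≤ : ∀ {y′} → y′ ℤ.≤ y → from (ℤ.suc y) ℕ.≤ from (ℤ.suc y′)
    from-suc≤ y′≤y = beadsFrom-antitone λ' (ℤP.suc-mono y′≤y)

    beadsIn-suc≡ : beadsIn λ' n (ℤ.suc y) ≡ from (ℤ.suc (y ℤ.- + n)) ℕ.∸ from (ℤ.suc y)
    beadsIn-suc≡ = cong (λ z → from z ℕ.∸ from (ℤ.suc y)) (suc-minus y n)

  beadsIn-gap-bead : Gap λ' y → Bead λ' (y ℤ.- + n) → beadsIn λ' n y ≡ suc (beadsIn λ' n (ℤ.suc y))
  beadsIn-gap-bead gap bead = begin
    from (y ℤ.- + n) ℕ.∸ from y                                  ≡⟨ cong₂ ℕ._∸_ bead gap ⟩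
    suc (from (ℤ.suc (y ℤ.- + n))) ℕ.∸ from (ℤ.suc y)           ≡⟨ ℕP.+-∸-assoc 1 (from-suc≤ (ℤP.i-j≤i y (+ n))) ⟩
    suc (from (ℤ.suc (y ℤ.- + n)) ℕ.∸ from (ℤ.suc y))           ≡⟨ cong suc (sym beadsIn-suc≡) ⟩
    suc (beadsIn λ' n (ℤ.suc y))                                 ∎
    where open ≡-Reasoning

  beadsIn-bead-gap : Bead λ' y → Gap λ' (y ℤ.- + n) → beadsIn λ' n (ℤ.suc y) ≡ suc (beadsIn λ' n y)
  beadsIn-bead-gap bead gap = begin
    beadsIn λ' n (ℤ.suc y)                                       ≡⟨ beadsIn-suc≡ ⟩
    from (ℤ.suc (y ℤ.- + n)) ℕ.∸ from (ℤ.suc y)                 ≡⟨ cong (ℕ._∸ from (ℤ.suc y)) (sym gap) ⟩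
    suc (from (y ℤ.- + n)) ℕ.∸ suc (from (ℤ.suc y))             ≡⟨ ℕP.+-∸-assoc 1 sy≤ ⟩
    suc (from (y ℤ.- + n) ℕ.∸ suc (from (ℤ.suc y)))             ≡⟨ cong (λ z → suc (from (y ℤ.- + n) ℕ.∸ z)) (sym bead) ⟩
    suc (beadsIn λ' n y)                                         ∎
    where
    open ≡-Reasoning
    sy≤ : suc (from (ℤ.suc y)) ℕ.≤ from (y ℤ.- + n)
    sy≤ = subst (ℕ._≤ from (y ℤ.- + n)) bead (beadsFrom-antitone λ' (ℤP.i-j≤i y (+ n)))

  beadsIn-gap-gap : Gap λ' y → Gap λ' (y ℤ.- + n) → beadsIn λ' n (ℤ.suc y) ≡ beadsIn λ' n y
  beadsIn-gap-gap gap gap-n = trans beadsIn-suc≡ (sym (cong₂ ℕ._∸_ gap-n gap))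

  beadsIn-bead-bead : Bead λ' y → Bead λ' (y ℤ.- + n) → beadsIn λ' n (ℤ.suc y) ≡ beadsIn λ' n y
  beadsIn-bead-bead bead bead-n = trans beadsIn-suc≡ (sym (cong₂ ℕ._∸_ bead-n bead))

-- The rows of a ribbon

rowSum : (ℕ → ℕ) → ℕ → ℕ
rowSum f zero    = 0
rowSum f (suc L) = f 0 ℕ.+ rowSum (λ r → f (suc r)) L

rowSum-suc : ∀ f L → rowSum f (suc L) ≡ rowSum f L ℕ.+ f L
rowSum-suc f zero    = ℕP.+-comm (f 0) 0
rowSum-suc f (suc L) = trans (cong (f 0 ℕ.+_) (rowSum-suc (λ r → f (suc r)) L)) (sym (ℕP.+-assoc (f 0) _ _))

sum≡rowSum : ∀ xs L → length xs ℕ.≤ L → sum xs ≡ rowSum (partAt xs) L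
sum≡rowSum []       L       _       = sym (rowSum-0 L)
  where
  rowSum-0 : ∀ L → rowSum (λ _ → 0) L ≡ 0
  rowSum-0 zero    = refl
  rowSum-0 (suc L) = rowSum-0 L
sum≡rowSum (x ∷ xs) (suc L) (s≤s p) = cong (x ℕ.+_) (sum≡rowSum xs L p)

rowsBelow-suc-< : ∀ μ λ' m → row λ' m ℕ.< row μ m → rowsBelow μ λ' (suc m) ≡ suc (rowsBelow μ λ' m)
rowsBelow-suc-< μ λ' m p with row λ' m ℕ.<ᵇ row μ m | ℕP.<⇒<ᵇ p
... | true | _ = refl

rowsBelow-suc-≡ : ∀ μ λ' m → row μ m ≡ row λ' m → rowsBelow μ λ' (suc m) ≡ rowsBelow μ λ' m
rowsBelow-suc-≡ μ λ' m eq with row λ' m ℕ.<ᵇ row μ m | ℕP.<ᵇ⇒< (row λ' m) (row μ m)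
... | true  | lt = ⊥-elim (ℕP.<-irrefl (sym eq) (lt _))
... | false | _  = refl

-- μ / λ' occupies exactly the rows r0, …, r1, and each of its rows below r0
-- ends just below where the previous row starts: this is the shape of a ribbon.
record RibbonRows (μ λ' : Partition) (r0 r1 : ℕ) : Set where
  field
    r0≤r1   : r0 ℕ.≤ r1
    above   : ∀ r → r ℕ.< r0 → row μ r ≡ row λ' r
    below   : ∀ r → r1 ℕ.< r → row μ r ≡ row λ' r
    shifted : ∀ r → r0 ℕ.≤ r → r ℕ.< r1 → row μ (suc r) ≡ suc (row λ' r)
    top     : row λ' r0 ℕ.< row μ r0

module RibbonRowsProperties {μ λ' : Partition} {r0 r1 : ℕ} (R : RibbonRows μ λ' r0 r1) where
  open RibbonRows R

  grows : ∀ r → r0 ℕ.≤ r → r ℕ.≤ r1 → row λ' r ℕ.< row μ r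
  grows r r0≤r r≤r1 with ℕP.m≤n⇒m<n∨m≡n r0≤r
  ... | inj₂ refl = top
  grows (suc r) _ r≤r1 | inj₁ (s≤s r0≤r) =
    subst (row λ' (suc r) ℕ.<_) (sym (shifted r r0≤r r≤r1)) (s≤s (row-suc≤ λ' r))

  ⊆ : λ' ⊆ₚ μ
  ⊆ r with r ℕ.<? r0 | r1 ℕ.<? r
  ... | yes r<r0 | _        = ℕP.≤-reflexive (sym (above r r<r0))
  ... | no _     | yes r1<r = ℕP.≤-reflexive (sym (below r r1<r))
  ... | no r≮r0  | no r≯r1  = ℕP.<⇒≤ (grows r (ℕP.≮⇒≥ r≮r0) (ℕP.≮⇒≥ r≯r1))

  skew⇒rows : ∀ r c → InSkew μ λ' (r , c) → r0 ℕ.≤ r × r ℕ.≤ r1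
  skew⇒rows r c (λ≤c , c<μ) with r ℕ.<? r0 | r1 ℕ.<? r
  ... | yes r<r0 | _        = ⊥-elim (ℕP.<-irrefl refl (ℕP.≤-<-trans λ≤c (subst (c ℕ.<_) (above r r<r0) c<μ)))
  ... | no _     | yes r1<r = ⊥-elim (ℕP.<-irrefl refl (ℕP.≤-<-trans λ≤c (subst (c ℕ.<_) (below r r1<r) c<μ)))
  ... | no r≮r0  | no r≯r1  = ℕP.≮⇒≥ r≮r0 , ℕP.≮⇒≥ r≯r1

  no2x2 : No2x2 μ λ' 
  no2x2 r c (topLeft , _ , _ , bottomRight) with skew⇒rows r c topLeft | skew⇒rows (suc r) (suc c) bottomRight
  ... | r0≤r , _ | _ , sr≤r1 = ℕP.<-irrefl refl (ℕP.≤-<-trans (proj₁ topLeft)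
          (ℕP.≤-pred (subst (suc c ℕ.<_) (shifted r r0≤r sr≤r1) (proj₂ bottomRight))))

  headColumn : ℕ
  headColumn = ℕ.pred (row μ r0)

  suc-headColumn : suc headColumn ≡ row μ r0
  suc-headColumn = ℕP.suc-pred (row μ r0) {{ℕ.>-nonZero (ℕP.≤-<-trans z≤n top)}}

  head : IsHead μ λ' (r0 , headColumn)
  head = (ℕP.≤-pred (subst (row λ' r0 ℕ.<_) (sym suc-headColumn) top) ,
          subst (headColumn ℕ.<_) suc-headColumn ℕP.≤-refl) ,
         λ { (r , c) inSkew → topRight r c inSkew }
    where
    topRight : ∀ r c → InSkew μ λ' (r , c) → r0 ℕ.< r ⊎ (r0 ≡ r × c ℕ.≤ headColumn)
    topRight r c inSkew with ℕP.m≤n⇒m<n∨m≡n (proj₁ (skew⇒rows r c inSkew))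
    ... | inj₁ r0<r = inj₁ r0<r
    ... | inj₂ refl = inj₂ (refl , ℕP.≤-pred (subst (c ℕ.<_) (sym suc-headColumn) (proj₂ inSkew)))

  rowsBelow-upTo-r0 : ∀ m → m ℕ.≤ r0 → rowsBelow μ λ' m ≡ 0
  rowsBelow-upTo-r0 zero    _    = refl
  rowsBelow-upTo-r0 (suc m) m<r0 = trans (rowsBelow-suc-≡ μ λ' m (above m m<r0)) (rowsBelow-upTo-r0 m (ℕP.<⇒≤ m<r0))

  rowsBelow-inside : ∀ t → r0 ℕ.+ t ℕ.≤ suc r1 → rowsBelow μ λ' (r0 ℕ.+ t) ≡ t
  rowsBelow-inside zero _ rewrite ℕP.+-identityʳ r0 = rowsBelow-upTo-r0 r0 ℕP.≤-refl
  rowsBelow-inside (suc t) p rewrite ℕP.+-suc r0 t =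
    trans (rowsBelow-suc-< μ λ' (r0 ℕ.+ t) (grows (r0 ℕ.+ t) (ℕP.m≤m+n r0 t) (ℕP.≤-pred p)))
          (cong suc (rowsBelow-inside t (ℕP.<⇒≤ p)))

  rowsBelow-beyond-r1 : ∀ m → r1 ℕ.< m → rowsBelow μ λ' m ≡ suc (r1 ℕ.∸ r0)
  rowsBelow-beyond-r1 (suc m) (s≤s r1≤m) with ℕP.m≤n⇒m<n∨m≡n r1≤m
  ... | inj₁ r1<m = trans (rowsBelow-suc-≡ μ λ' m (below m r1<m)) (rowsBelow-beyond-r1 m r1<m)
  ... | inj₂ refl = trans (cong (rowsBelow μ λ') (sym r0+rows≡)) (rowsBelow-inside _ (ℕP.≤-reflexive r0+rows≡))
    where
    r0+rows≡ : r0 ℕ.+ suc (r1 ℕ.∸ r0) ≡ suc r1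
    r0+rows≡ = trans (ℕP.+-suc r0 _) (cong suc (ℕP.m+[n∸m]≡n r0≤r1))

  numRows≡ : numRows μ λ' ≡ suc (r1 ℕ.∸ r0)
  numRows≡ = rowsBelow-beyond-r1 _ (partAt-nonzero⇒< (parts μ) r1 (ℕP.≤-<-trans z≤n (grows r1 r0≤r1 ℕP.≤-refl)))

  private
    S T : ℕ → ℕ
    S = rowSum (row μ)
    T = rowSum (row λ')

    balance-above : ∀ L → L ℕ.≤ r0 → S L ≡ T L
    balance-above zero    _    = refl
    balance-above (suc L) L<r0 rewrite rowSum-suc (row μ) L | rowSum-suc (row λ') L | above L L<r0 =
      cong (ℕ._+ row λ' L) (balance-above L (ℕP.<⇒≤ L<r0))

    balance-inside : ∀ t → r0 ℕ.+ t ℕ.≤ r1 →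
      S (suc (r0 ℕ.+ t)) ℕ.+ row λ' (r0 ℕ.+ t) ℕ.+ r0 ≡ T (suc (r0 ℕ.+ t)) ℕ.+ row μ r0 ℕ.+ (r0 ℕ.+ t)
    balance-inside zero _ rewrite ℕP.+-identityʳ r0 | rowSum-suc (row μ) r0 | rowSum-suc (row λ') r0
                                | balance-above r0 ℕP.≤-refl = swap (T r0) (row μ r0) (row λ' r0) r0
      where
      swap : ∀ t m a r → t ℕ.+ m ℕ.+ a ℕ.+ r ≡ t ℕ.+ a ℕ.+ m ℕ.+ r
      swap = ℕ-Solver.solve-∀
    balance-inside (suc t) r0+t<r1 = begin
      S (suc (r0 ℕ.+ suc t)) ℕ.+ row λ' (r0 ℕ.+ suc t) ℕ.+ r0
        ≡⟨ cong (λ z → S (suc z) ℕ.+ row λ' z ℕ.+ r0) (ℕP.+-suc r0 t) ⟩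
      S (suc (suc r)) ℕ.+ row λ' (suc r) ℕ.+ r0
        ≡⟨ cong (λ z → z ℕ.+ row λ' (suc r) ℕ.+ r0) (rowSum-suc (row μ) (suc r)) ⟩
      S (suc r) ℕ.+ row μ (suc r) ℕ.+ row λ' (suc r) ℕ.+ r0
        ≡⟨ cong (λ z → S (suc r) ℕ.+ z ℕ.+ row λ' (suc r) ℕ.+ r0) (shifted r (ℕP.m≤m+n r0 t) r<r1) ⟩
      S (suc r) ℕ.+ suc (row λ' r) ℕ.+ row λ' (suc r) ℕ.+ r0
        ≡⟨ regroupˡ (S (suc r)) (row λ' r) (row λ' (suc r)) r0 ⟩
      suc (S (suc r) ℕ.+ row λ' r ℕ.+ r0 ℕ.+ row λ' (suc r))
        ≡⟨ cong (λ z → suc (z ℕ.+ row λ' (suc r))) (balance-inside t (ℕP.<⇒≤ r<r1)) ⟩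
      suc (T (suc r) ℕ.+ row μ r0 ℕ.+ r ℕ.+ row λ' (suc r))
        ≡⟨ regroupʳ (T (suc r)) (row μ r0) r (row λ' (suc r)) ⟩
      T (suc r) ℕ.+ row λ' (suc r) ℕ.+ row μ r0 ℕ.+ suc r
        ≡⟨ cong (λ z → z ℕ.+ row μ r0 ℕ.+ suc r) (sym (rowSum-suc (row λ') (suc r))) ⟩
      T (suc (suc r)) ℕ.+ row μ r0 ℕ.+ suc r
        ≡⟨ cong (λ z → T (suc z) ℕ.+ row μ r0 ℕ.+ z) (sym (ℕP.+-suc r0 t)) ⟩
      T (suc (r0 ℕ.+ suc t)) ℕ.+ row μ r0 ℕ.+ (r0 ℕ.+ suc t) ∎
      where
      open ≡-Reasoning
      r : ℕ
      r = r0 ℕ.+ t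
      r<r1 : r ℕ.< r1
      r<r1 = subst (ℕ._≤ r1) (ℕP.+-suc r0 t) r0+t<r1
      regroupˡ : ∀ s a b r → s ℕ.+ suc a ℕ.+ b ℕ.+ r ≡ suc (s ℕ.+ a ℕ.+ r ℕ.+ b)
      regroupˡ = ℕ-Solver.solve-∀
      regroupʳ : ∀ t m r b → suc (t ℕ.+ m ℕ.+ r ℕ.+ b) ≡ t ℕ.+ b ℕ.+ m ℕ.+ suc r
      regroupʳ = ℕ-Solver.solve-∀

    balance-below : ∀ u → S (suc r1 ℕ.+ u) ℕ.+ row λ' r1 ℕ.+ r0 ≡ T (suc r1 ℕ.+ u) ℕ.+ row μ r0 ℕ.+ r1
    balance-below zero rewrite ℕP.+-identityʳ r1 =
      subst (λ z → S (suc z) ℕ.+ row λ' z ℕ.+ r0 ≡ T (suc z) ℕ.+ row μ r0 ℕ.+ z)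
            (ℕP.m+[n∸m]≡n r0≤r1) (balance-inside (r1 ℕ.∸ r0) (ℕP.≤-reflexive (ℕP.m+[n∸m]≡n r0≤r1)))
    balance-below (suc u) rewrite ℕP.+-suc r1 u | rowSum-suc (row μ) (suc r1 ℕ.+ u) | rowSum-suc (row λ') (suc r1 ℕ.+ u)
                                | below (suc r1 ℕ.+ u) (s≤s (ℕP.m≤m+n r1 u)) =
      trans (move (S (suc r1 ℕ.+ u)) (row λ' (suc r1 ℕ.+ u)) (row λ' r1) r0)
            (trans (cong (ℕ._+ row λ' (suc r1 ℕ.+ u)) (balance-below u))
                   (sym (move (T (suc r1 ℕ.+ u)) (row λ' (suc r1 ℕ.+ u)) (row μ r0) r1)))
      where
      move : ∀ s x a r → s ℕ.+ x ℕ.+ a ℕ.+ r ≡ s ℕ.+ a ℕ.+ r ℕ.+ x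
      move = ℕ-Solver.solve-∀

  size-balance : size μ ℕ.+ row λ' r1 ℕ.+ r0 ≡ size λ' ℕ.+ row μ r0 ℕ.+ r1
  size-balance rewrite sum≡rowSum (parts μ) (suc r1 ℕ.+ (length (parts μ) ℕ.+ length (parts λ')))
                                  (ℕP.≤-trans (ℕP.m≤m+n _ _) (ℕP.m≤n+m _ (suc r1)))
                     | sum≡rowSum (parts λ') (suc r1 ℕ.+ (length (parts μ) ℕ.+ length (parts λ')))
                                  (ℕP.≤-trans (ℕP.m≤n+m _ _) (ℕP.m≤n+m _ (suc r1))) = balance-below _

  size-gap⇒β : ∀ n → size μ ≡ size λ' ℕ.+ n → β λ' r1 ≡ β μ r0 ℤ.- + n
  size-gap⇒β n size≡ = sum-eq⇒diff-eq n (row λ' r1) (row μ r0) r0 r1 (ℕP.+-cancelˡ-≡ (size λ') _ _ (begin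
    size λ' ℕ.+ (n ℕ.+ row λ' r1 ℕ.+ r0)   ≡⟨ reassoc (size λ') n (row λ' r1) r0 ⟩
    size λ' ℕ.+ n ℕ.+ row λ' r1 ℕ.+ r0     ≡⟨ cong (λ z → z ℕ.+ row λ' r1 ℕ.+ r0) (sym size≡) ⟩
    size μ ℕ.+ row λ' r1 ℕ.+ r0            ≡⟨ size-balance ⟩
    size λ' ℕ.+ row μ r0 ℕ.+ r1            ≡⟨ ℕP.+-assoc (size λ') _ _ ⟩
    size λ' ℕ.+ (row μ r0 ℕ.+ r1)          ∎))
    where
    open ≡-Reasoning
    reassoc : ∀ s n a r → s ℕ.+ (n ℕ.+ a ℕ.+ r) ≡ s ℕ.+ n ℕ.+ a ℕ.+ r
    reassoc = ℕ-Solver.solve-∀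

  β⇒size-gap : ∀ n → β λ' r1 ≡ β μ r0 ℤ.- + n → size μ ≡ size λ' ℕ.+ n
  β⇒size-gap n β≡ = ℕP.+-cancelʳ-≡ (row λ' r1 ℕ.+ r0) _ _ (begin
    size μ ℕ.+ (row λ' r1 ℕ.+ r0)          ≡⟨ sym (ℕP.+-assoc (size μ) _ _) ⟩
    size μ ℕ.+ row λ' r1 ℕ.+ r0            ≡⟨ size-balance ⟩
    size λ' ℕ.+ row μ r0 ℕ.+ r1            ≡⟨ ℕP.+-assoc (size λ') _ _ ⟩
    size λ' ℕ.+ (row μ r0 ℕ.+ r1)
      ≡⟨ cong (size λ' ℕ.+_) (sym (diff-eq⇒sum-eq n (row λ' r1) (row μ r0) r0 r1 β≡)) ⟩
    size λ' ℕ.+ (n ℕ.+ row λ' r1 ℕ.+ r0)   ≡⟨ reassoc (size λ') n (row λ' r1) r0 ⟩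
    size λ' ℕ.+ n ℕ.+ (row λ' r1 ℕ.+ r0)   ∎)
    where
    open ≡-Reasoning
    reassoc : ∀ s n a r → s ℕ.+ (n ℕ.+ a ℕ.+ r) ≡ s ℕ.+ n ℕ.+ (a ℕ.+ r)
    reassoc = ℕ-Solver.solve-∀

  private
    Step : Box → Box → Set
    Step = SkewAdj μ λ'

    walkRight : ∀ r e → suc e ≡ row μ r → ∀ k c → c ℕ.+ k ≡ e → InSkew μ λ' (r , c) → Star Step (r , c) (r , e)
    walkRight r e _    zero    c refl inSkew rewrite ℕP.+-identityʳ c = ε
    walkRight r e se≡μ (suc k) c c+k≡e inSkew =
      (inSkew , inSkew′ , inj₁ (refl , inj₁ refl)) ◅ walkRight r e se≡μ k (suc c) c+k≡e′ inSkew′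
      where
      c+k≡e′ : suc c ℕ.+ k ≡ e
      c+k≡e′ = trans (sym (ℕP.+-suc c k)) c+k≡e
      inSkew′ : InSkew μ λ' (r , suc c)
      inSkew′ = ℕP.m≤n⇒m≤1+n (proj₁ inSkew) ,
                subst (suc c ℕ.<_) se≡μ (s≤s (subst (suc c ℕ.≤_) c+k≡e′ (ℕP.m≤m+n (suc c) k)))

    toRowEnd : ∀ r e → suc e ≡ row μ r → ∀ c → InSkew μ λ' (r , c) → Star Step (r , c) (r , e)
    toRowEnd r e se≡μ c inSkew = walkRight r e se≡μ (e ℕ.∸ c) c (ℕP.m+[n∸m]≡n c≤e) inSkew
      where
      c≤e : c ℕ.≤ e
      c≤e = ℕP.≤-pred (subst (suc c ℕ.≤_) (sym se≡μ) (proj₂ inSkew))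

    -- The last box of row r + 1 sits right below the first box of row r.
    toHead : ∀ t c → r0 ℕ.+ t ℕ.≤ r1 → InSkew μ λ' (r0 ℕ.+ t , c) → Star Step (r0 ℕ.+ t , c) (r0 , headColumn)
    toHead zero c _ inSkew rewrite ℕP.+-identityʳ r0 = toRowEnd r0 headColumn suc-headColumn c inSkew
    toHead (suc t) c r0+t<r1 inSkew rewrite ℕP.+-suc r0 t =
      toRowEnd (suc r) (row λ' r) (sym μ-shifted) c inSkew ◅◅
      ((end , start , inj₂ (refl , inj₂ refl)) ◅ toHead t (row λ' r) (ℕP.<⇒≤ r0+t<r1) start)
      where
      r : ℕ
      r = r0 ℕ.+ t
      μ-shifted : row μ (suc r) ≡ suc (row λ' r)
      μ-shifted = shifted r (ℕP.m≤m+n r0 t) r0+t<r1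
      end : InSkew μ λ' (suc r , row λ' r)
      end = row-suc≤ λ' r , subst (row λ' r ℕ.<_) (sym μ-shifted) ℕP.≤-refl
      start : InSkew μ λ' (r , row λ' r)
      start = ℕP.≤-refl , grows r (ℕP.m≤m+n r0 t) (ℕP.<⇒≤ r0+t<r1)

    toHead′ : ∀ b → InSkew μ λ' b → Star Step b (r0 , headColumn)
    toHead′ (r , c) inSkew with skew⇒rows r c inSkew
    ... | r0≤r , r≤r1 = subst (λ z → Star Step (z , c) (r0 , headColumn)) r0+[r∸r0]≡r
          (toHead (r ℕ.∸ r0) c (subst (ℕ._≤ r1) (sym r0+[r∸r0]≡r) r≤r1)
                  (subst (λ z → InSkew μ λ' (z , c)) (sym r0+[r∸r0]≡r) inSkew))
      where
      r0+[r∸r0]≡r : r0 ℕ.+ (r ℕ.∸ r0) ≡ r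
      r0+[r∸r0]≡r = ℕP.m+[n∸m]≡n r0≤r

    adj-sym : ∀ {a b} → Adj a b → Adj b a
    adj-sym (inj₁ (eq , inj₁ p)) = inj₁ (sym eq , inj₂ (sym p))
    adj-sym (inj₁ (eq , inj₂ p)) = inj₁ (sym eq , inj₁ (sym p))
    adj-sym (inj₂ (eq , inj₁ p)) = inj₂ (sym eq , inj₂ (sym p))
    adj-sym (inj₂ (eq , inj₂ p)) = inj₂ (sym eq , inj₁ (sym p))

  connected : Connected μ λ'
  connected a b inSkewA inSkewB =
    toHead′ a inSkewA ◅◅ reverse (λ (p , q , adj) → q , p , adj-sym adj) (toHead′ b inSkewB)

  isRibbon : ∀ n → size μ ≡ size λ' ℕ.+ n → IsRibbon n μ λ'
  isRibbon n size≡ = ⊆ , size≡ , connected , no2x2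

-- No box of μ / λ' in row r + 1 is adjacent to a box of μ / λ' in row r.
Cut : Partition → Partition → ℕ → Set
Cut μ λ' r = row μ (suc r) ℕ.≤ row λ' r

cut-confines : ∀ {μ λ' r a b} → Cut μ λ' r → Star (SkewAdj μ λ') a b → proj₁ a ℕ.≤ r → proj₁ b ℕ.≤ r
cut-confines cut ε a≤r = a≤r
cut-confines {μ} {λ'} {r} cut (step ◅ path) a≤r = cut-confines {μ} {λ'} cut path (oneStep step a≤r)
  where
  oneStep : ∀ {a b} → SkewAdj μ λ' a b → proj₁ a ℕ.≤ r → proj₁ b ℕ.≤ r
  oneStep (_ , _ , inj₁ (refl , _))       a≤r = a≤r
  oneStep (_ , _ , inj₂ (_ , inj₂ refl)) a≤r = ℕP.≤-trans (ℕP.n≤1+n _) a≤r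
  oneStep (inA , inB , inj₂ (refl , inj₁ refl)) a≤r with ℕP.m≤n⇒m<n∨m≡n a≤r
  ... | inj₁ a<r  = a<r
  ... | inj₂ refl = ⊥-elim (ℕP.<-irrefl refl (ℕP.<-≤-trans (proj₂ inB) (ℕP.≤-trans cut (proj₁ inA))))

module RibbonAnalysis {n : ℕ} {μ λ' : Partition} {r0 c0 : ℕ}
                      (rib : IsRibbon n μ λ') (hd : IsHead μ λ' (r0 , c0)) where

  private
    ⊆ : λ' ⊆ₚ μ
    ⊆ = proj₁ rib
    connected : Connected μ λ'
    connected = proj₁ (proj₂ (proj₂ rib))
    no2x2 : No2x2 μ λ'
    no2x2 = proj₂ (proj₂ (proj₂ rib))

    rows≡ : ∀ r → ¬ (row λ' r ℕ.< row μ r) → row μ r ≡ row λ' r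
    rows≡ r ≮ = ℕP.≤-antisym (ℕP.≮⇒≥ ≮) (⊆ r)

    r0≤ : ∀ r c → InSkew μ λ' (r , c) → r0 ℕ.≤ r
    r0≤ r c inSkew with proj₂ hd (r , c) inSkew
    ... | inj₁ r0<r      = ℕP.<⇒≤ r0<r
    ... | inj₂ (refl , _) = ℕP.≤-refl

  top : row λ' r0 ℕ.< row μ r0
  top = ℕP.≤-<-trans (proj₁ (proj₁ hd)) (proj₂ (proj₁ hd))

  row-head : row μ r0 ≡ suc c0
  row-head = ℕP.≤-antisym μr0≤ (proj₂ (proj₁ hd))
    where
    last : ℕ
    last = ℕ.pred (row μ r0)
    suc-last : suc last ≡ row μ r0
    suc-last = ℕP.suc-pred (row μ r0) {{ℕ.>-nonZero (ℕP.≤-<-trans z≤n top)}}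
    μr0≤ : row μ r0 ℕ.≤ suc c0
    μr0≤ with proj₂ hd (r0 , last) (ℕP.≤-pred (subst (row λ' r0 ℕ.<_) (sym suc-last) top) ,
                                   subst (last ℕ.<_) suc-last ℕP.≤-refl)
    ... | inj₁ r0<r0     = ⊥-elim (ℕP.<-irrefl refl r0<r0)
    ... | inj₂ (_ , l≤c0) = subst (ℕ._≤ suc c0) suc-last (s≤s l≤c0)

  private
    firstCut : ∃ (Least (λ t → Cut μ λ' (r0 ℕ.+ t)))
    firstCut = least (λ t → row μ (suc (r0 ℕ.+ t)) ℕ.≤? row λ' (r0 ℕ.+ t)) (length (parts μ))
      (subst (ℕ._≤ row λ' (r0 ℕ.+ length (parts μ)))
             (sym (partAt-beyond (parts μ) _ (ℕP.m≤n⇒m≤1+n (ℕP.m≤n+m _ r0)))) z≤n)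

  r1 : ℕ
  r1 = r0 ℕ.+ proj₁ firstCut

  ribbonRows : RibbonRows μ λ' r0 r1
  ribbonRows = record
    { r0≤r1 = ℕP.m≤m+n r0 _ ; above = above ; below = below ; shifted = shifted ; top = top }
    where
    above : ∀ r → r ℕ.< r0 → row μ r ≡ row λ' r
    above r r<r0 = rows≡ r (λ grows → ℕP.<⇒≱ r<r0 (r0≤ r (row λ' r) (ℕP.≤-refl , grows)))

    -- A box below the first cut could not be connected to the head.
    below : ∀ r → r1 ℕ.< r → row μ r ≡ row λ' r
    below r r1<r = rows≡ r (λ grows → ℕP.<⇒≱ r1<r
      (cut-confines {μ} {λ'} (proj₁ (proj₂ firstCut))
         (connected (r0 , c0) (r , row λ' r) (proj₁ hd) (ℕP.≤-refl , grows)) (ℕP.m≤m+n r0 _)))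

    -- No cut forces μ (r+1) > λ' r, and no 2×2 square forces μ (r+1) ≤ λ' r + 1.
    shifted : ∀ r → r0 ℕ.≤ r → r ℕ.< r1 → row μ (suc r) ≡ suc (row λ' r)
    shifted r r0≤r r<r1 = ℕP.≤-antisym (ℕP.≮⇒≥ square) (ℕP.≰⇒> noCut)
      where
      r0+[r∸r0]≡r : r0 ℕ.+ (r ℕ.∸ r0) ≡ r
      r0+[r∸r0]≡r = ℕP.m+[n∸m]≡n r0≤r
      noCut : ¬ Cut μ λ' r
      noCut cut = proj₂ (proj₂ firstCut) (r ℕ.∸ r0)
        (ℕP.+-cancelˡ-< r0 _ _ (subst (ℕ._< r1) (sym r0+[r∸r0]≡r) r<r1))
        (subst (Cut μ λ') (sym r0+[r∸r0]≡r) cut)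
      square : ¬ (suc (row λ' r) ℕ.< row μ (suc r))
      square h = no2x2 r (row λ' r)
        ((ℕP.≤-refl , ℕP.<-≤-trans (ℕP.<-trans (ℕP.n<1+n _) h) (row-suc≤ μ r)) ,
         (ℕP.n≤1+n _ , ℕP.<-≤-trans h (row-suc≤ μ r)) ,
         (row-suc≤ λ' r , ℕP.<-trans (ℕP.n<1+n _) h) ,
         (ℕP.m≤n⇒m≤1+n (row-suc≤ λ' r) , h))

-- Ribbons as bead moves

-- Adding the n-ribbon μ / λ' moves the bead of row r1 from y - n up to y, where it
-- becomes the bead of row r0; it jumps over the s beads of rows r0, …, r1 - 1.
record BeadMove (n : ℕ) (μ λ' : Partition) (y : ℤ) (s : ℕ) : Set where
  field
    r0 r1    : ℕ
    rows     : RibbonRows μ λ' r0 r1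
    β-top    : β μ r0 ≡ y
    β-bottom : β λ' r1 ≡ y ℤ.- + n
    spin     : r1 ℕ.∸ r0 ≡ s

ribbon⇒beadMove : ∀ {n λ' μ k s} → AddRibbon n λ' μ k s → BeadMove n μ λ' (ℤ.suc k) s
ribbon⇒beadMove {n} {λ'} {μ} {k} {s} (rib , ((r0 , c0) , hd , diag≡k) , numRows≡s) = record
  { r0 = r0 ; r1 = r1 ; rows = ribbonRows
  ; β-top = β-top ; β-bottom = β-bottom ; spin = spin }
  where
  open RibbonAnalysis {n} {μ} {λ'} rib hd
  open RibbonRowsProperties ribbonRows using (size-gap⇒β; numRows≡)
  β-top : β μ r0 ≡ ℤ.suc k
  β-top = trans (cong (λ z → + z ℤ.- + r0) row-head) (trans (suc-minus (+ c0) r0) (cong ℤ.suc diag≡k))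
  β-bottom : β λ' r1 ≡ ℤ.suc k ℤ.- + n
  β-bottom = trans (size-gap⇒β n (proj₁ (proj₂ rib))) (cong (ℤ._- + n) β-top)
  spin : r1 ℕ.∸ r0 ≡ s
  spin = ℕP.suc-injective (trans (sym numRows≡) numRows≡s)

beadMove⇒ribbon : ∀ {n λ' μ k s} → BeadMove n μ λ' (ℤ.suc k) s → AddRibbon n λ' μ k s
beadMove⇒ribbon {n} {λ'} {μ} {k} move@record { spin = refl } =
  isRibbon n (β⇒size-gap n (trans β-bottom (cong (ℤ._- + n) (sym β-top)))) ,
  ((r0 , headColumn) , head , diag≡k) , numRows≡
  where
  open BeadMove move
  open RibbonRowsProperties rows
  diag≡k : diag (r0 , headColumn) ≡ k
  diag≡k = ℤsuc-injective (trans (sym (suc-minus (+ headColumn) r0))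
                                 (trans (cong (λ z → + z ℤ.- + r0) suc-headColumn) β-top))

module _ {n : ℕ} {μ λ' : Partition} {y : ℤ} {s : ℕ} (move : BeadMove n μ λ' y s) where
  open BeadMove move
  open RibbonRows rows

  beadMove-inner : Gap λ' y × Bead λ' (y ℤ.- + n) × beadsIn λ' n (ℤ.suc y) ≡ s
  beadMove-inner = trans from-y (sym from-suc-y) , bead-atβ λ' r1 _ β-bottom ,
                   trans (cong₂ ℕ._∸_ from-suc-[y-n] from-suc-y) spin
    where
    above-r0 : ∀ t → t ℕ.< r0 → ℤ.suc y ℤ.≤ β λ' t
    above-r0 t t<r0 = subst (ℤ.suc y ℤ.≤_) (cong (λ z → + z ℤ.- + t) (above t t<r0))
                        (ℤP.i<j⇒suc[i]≤j (subst (ℤ._< β μ t) β-top (β-strictlyAntitone μ t<r0)))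
    β-r0<y : β λ' r0 ℤ.< y
    β-r0<y = subst (β λ' r0 ℤ.<_) β-top (ℤP.+-monoˡ-< (ℤ.- + r0) (ℤ.+<+ top))
    from-suc-y : beadsFrom λ' (ℤ.suc y) ≡ r0
    from-suc-y = beadsFrom-unique λ' _ r0 above-r0 (ℤP.<-trans β-r0<y (i<suc[i] y))
    from-y : beadsFrom λ' y ≡ r0
    from-y = beadsFrom-unique λ' y r0 (λ t t<r0 → ℤP.≤-trans (ℤP.i≤suc[i] y) (above-r0 t t<r0)) β-r0<y
    from-suc-[y-n] : beadsFrom λ' (ℤ.suc y ℤ.- + n) ≡ r1
    from-suc-[y-n] = trans (cong (beadsFrom λ') (suc-minus y n)) (proj₁ (beadsFrom-atBead λ' r1 _ β-bottom))

  beadMove-outer : 1 ℕ.≤ n → Bead μ y × Gap μ (y ℤ.- + n) × beadsIn μ n y ≡ s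
  beadMove-outer 1≤n = bead-atβ μ r0 y β-top , trans from-[y-n] (sym from-suc-[y-n]) ,
                       trans (cong₂ ℕ._∸_ from-[y-n] (proj₂ (beadsFrom-atBead μ r0 y β-top))) spin
    where
    β-below-r1 : β μ (suc r1) ℤ.< y ℤ.- + n
    β-below-r1 = subst₂ ℤ._<_ (cong (λ z → + z ℤ.- + suc r1) (sym (below (suc r1) ℕP.≤-refl))) β-bottom
                        (β-suc< λ' r1)
    -- If the ribbon has several rows, the bead of row r1 of μ is the old bead of row r1 - 1.
    β-r1 : y ℤ.- + n ℤ.< β μ r1
    β-r1 with ℕP.m≤n⇒m<n∨m≡n r0≤r1
    ... | inj₂ refl = subst (y ℤ.- + n ℤ.<_) (sym β-top) (i-n<i y n 1≤n)
    β-r1 | inj₁ (s≤s {n = r} r0≤r) = subst₂ ℤ._<_ β-bottom βμ≡βλ (β-suc< λ' r)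
      where
      βμ≡βλ : β λ' r ≡ β μ (suc r)
      βμ≡βλ = trans (shift (+ row λ' r) (+ r)) (cong (λ z → + z ℤ.- + suc r) (sym (shifted r r0≤r ℕP.≤-refl)))
        where
        shift : ∀ a r → a ℤ.- r ≡ (1ℤ ℤ.+ a) ℤ.- (1ℤ ℤ.+ r)
        shift = solve-∀
    from-suc-[y-n] : beadsFrom μ (ℤ.suc (y ℤ.- + n)) ≡ suc r1
    from-suc-[y-n] = beadsFrom-unique-suc μ _ r1 (ℤP.i<j⇒suc[i]≤j β-r1) (ℤP.<-trans β-below-r1 (i<suc[i] _))
    from-[y-n] : beadsFrom μ (y ℤ.- + n) ≡ suc r1
    from-[y-n] = beadsFrom-unique-suc μ _ r1 (ℤP.<⇒≤ β-r1) β-below-r1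

-- Building partitions row by row

private
  nonzeroPrefix : ℕ → (ℕ → ℕ) → List ℕ
  nonzeroPrefix zero    f = []
  nonzeroPrefix (suc L) f with f 0
  ... | zero  = []
  ... | suc m = suc m ∷ nonzeroPrefix L (λ r → f (suc r))

  decreasing-zero : ∀ f → Decreasing f → f 0 ≡ 0 → ∀ r → f r ≡ 0
  decreasing-zero f f↓ f0≡0 zero    = f0≡0
  decreasing-zero f f↓ f0≡0 (suc r) =
    ℕP.n≤0⇒n≡0 (subst (f (suc r) ℕ.≤_) (decreasing-zero f f↓ f0≡0 r) (f↓ r))

  partAt-nonzeroPrefix : ∀ L f → Decreasing f → f L ≡ 0 → ∀ r → partAt (nonzeroPrefix L f) r ≡ f r
  partAt-nonzeroPrefix zero f f↓ fL≡0 r = sym (decreasing-zero f f↓ fL≡0 r)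
  partAt-nonzeroPrefix (suc L) f f↓ fL≡0 r with f 0 in f0≡
  ... | zero = sym (decreasing-zero f f↓ f0≡ r)
  partAt-nonzeroPrefix (suc L) f f↓ fL≡0 zero    | suc m = sym f0≡
  partAt-nonzeroPrefix (suc L) f f↓ fL≡0 (suc r) | suc m =
    partAt-nonzeroPrefix L (λ r → f (suc r)) (λ r → f↓ (suc r)) fL≡0 r

  linked-≥ : ∀ xs → (∀ r → partAt xs (suc r) ℕ.≤ partAt xs r) → Linked ℕ._≥_ xs
  linked-≥ []           _  = []
  linked-≥ (x ∷ [])     _  = [-]
  linked-≥ (x ∷ y ∷ xs) xs↓ = xs↓ 0 ∷ linked-≥ (y ∷ xs) (λ r → xs↓ (suc r))

  positive-nonzeroPrefix : ∀ L f → All (0 ℕ.<_) (nonzeroPrefix L f)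
  positive-nonzeroPrefix zero    f = []
  positive-nonzeroPrefix (suc L) f with f 0
  ... | zero  = []
  ... | suc m = s≤s z≤n ∷ positive-nonzeroPrefix L (λ r → f (suc r))

fromRows : (f : ℕ → ℕ) (L : ℕ) → Decreasing f → f L ≡ 0 → Partition
fromRows f L f↓ fL≡0 = mkPartition (nonzeroPrefix L f)
  (linked-≥ _ (λ r → subst₂ ℕ._≤_ (sym (partAt-nonzeroPrefix L f f↓ fL≡0 (suc r)))
                                  (sym (partAt-nonzeroPrefix L f f↓ fL≡0 r)) (f↓ r)))
  (positive-nonzeroPrefix L f)

row-fromRows : ∀ f L f↓ fL≡0 r → row (fromRows f L f↓ fL≡0) r ≡ f r
row-fromRows f L f↓ fL≡0 = partAt-nonzeroPrefix L f f↓ fL≡0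

splice : (g h : ℕ → ℕ) (r0 r1 : ℕ) → ℕ → ℕ
splice g h r0 r1 r with r ℕ.<? r0 | r1 ℕ.<? r
... | yes _ | _     = g r
... | no _  | yes _ = g r
... | no _  | no _  = h r

module _ (g h : ℕ → ℕ) (r0 r1 : ℕ) where

  splice-above : ∀ r → r ℕ.< r0 → splice g h r0 r1 r ≡ g r
  splice-above r r<r0 with r ℕ.<? r0
  ... | yes _   = refl
  ... | no r≮r0 = ⊥-elim (r≮r0 r<r0)

  splice-below : ∀ r → r1 ℕ.< r → splice g h r0 r1 r ≡ g r
  splice-below r r1<r with r ℕ.<? r0 | r1 ℕ.<? r
  ... | yes _ | _       = refl
  ... | no _  | yes _   = refl
  ... | no _  | no r≯r1 = ⊥-elim (r≯r1 r1<r)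

  splice-inside : ∀ r → r0 ℕ.≤ r → r ℕ.≤ r1 → splice g h r0 r1 r ≡ h r
  splice-inside r r0≤r r≤r1 with r ℕ.<? r0 | r1 ℕ.<? r
  ... | yes r<r0 | _        = ⊥-elim (ℕP.<⇒≱ r<r0 r0≤r)
  ... | no _     | yes r1<r = ⊥-elim (ℕP.<⇒≱ r1<r r≤r1)
  ... | no _     | no _     = refl

  splice-decreasing : r0 ℕ.≤ r1 → Decreasing g → (∀ r → r0 ℕ.≤ r → r ℕ.< r1 → h (suc r) ℕ.≤ h r) →
                      (∀ p → suc p ≡ r0 → h r0 ℕ.≤ g p) → g (suc r1) ℕ.≤ h r1 →
                      Decreasing (splice g h r0 r1)
  splice-decreasing r0≤r1 g↓ h↓ joinTop joinBottom r with ℕP.<-cmp (suc r) r0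
  ... | tri< sr<r0 _ _ = subst₂ ℕ._≤_ (sym (splice-above (suc r) sr<r0))
                           (sym (splice-above r (ℕP.<-trans (ℕP.n<1+n r) sr<r0))) (g↓ r)
  ... | tri≈ _ refl _  = subst₂ ℕ._≤_ (sym (splice-inside (suc r) ℕP.≤-refl r0≤r1))
                           (sym (splice-above r ℕP.≤-refl)) (joinTop r refl)
  ... | tri> _ _ r0≤r with ℕP.<-cmp r r1
  ...   | tri< r<r1 _ _ = subst₂ ℕ._≤_ (sym (splice-inside (suc r) (ℕP.m≤n⇒m≤1+n (ℕP.≤-pred r0≤r)) r<r1))
                            (sym (splice-inside r (ℕP.≤-pred r0≤r) (ℕP.<⇒≤ r<r1))) (h↓ r (ℕP.≤-pred r0≤r) r<r1)
  ...   | tri≈ _ refl _ = subst₂ ℕ._≤_ (sym (splice-below (suc r) ℕP.≤-refl))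
                            (sym (splice-inside r (ℕP.≤-pred r0≤r) ℕP.≤-refl)) joinBottom
  ...   | tri> _ _ r1<r = subst₂ ℕ._≤_ (sym (splice-below (suc r) (ℕP.m<n⇒m<1+n r1<r)))
                            (sym (splice-below r r1<r)) (g↓ r)

-- μ is λ' with the bead at y - n moved up to y.
module AddBead (n : ℕ) (λ' : Partition) (y : ℤ) (gap : Gap λ' y) (bead : Bead λ' (y ℤ.- + n)) where

  private
    g : ℕ → ℕ
    g = row λ'
    r0 r1 : ℕ
    r0 = beadsFrom λ' (ℤ.suc y)
    r1 = beadsFrom λ' (ℤ.suc (y ℤ.- + n))

    r0≤r1 : r0 ℕ.≤ r1
    r0≤r1 = beadsFrom-antitone λ' (ℤP.suc-mono (ℤP.i-j≤i y (+ n)))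

    gr0<y+r0 : + g r0 ℤ.< y ℤ.+ + r0
    gr0<y+r0 = β<⇒row< λ' r0 (gap⇒β< gap)

    Y : ℕ
    Y = ℤ.∣ y ℤ.+ + r0 ∣

    +Y≡ : + Y ≡ y ℤ.+ + r0
    +Y≡ = ℤP.0≤i⇒+∣i∣≡i (ℤP.<⇒≤ (ℤP.≤-<-trans (ℤ.+≤+ z≤n) gr0<y+r0))

    g<Y : g r0 ℕ.< Y
    g<Y = ℤP.drop‿+<+ (subst (+ g r0 ℤ.<_) (sym +Y≡) gr0<y+r0)

    Y≤above : ∀ p → suc p ≡ r0 → Y ℕ.≤ g p
    Y≤above p sp≡r0 = ℤP.drop‿+≤+ (subst (ℤ._≤ + g p) y+1+p≡Y
      (≤β⇒≤row λ' p (≤β-beforeBeadsFrom λ' (ℤ.suc y) p (subst (p ℕ.<_) sp≡r0 ℕP.≤-refl))))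
      where
      swap : ∀ y p → (1ℤ ℤ.+ y) ℤ.+ p ≡ y ℤ.+ (1ℤ ℤ.+ p)
      swap = solve-∀
      y+1+p≡Y : ℤ.suc y ℤ.+ + p ≡ + Y
      y+1+p≡Y = trans (swap y (+ p)) (trans (cong (λ z → y ℤ.+ + z) sp≡r0) (sym +Y≡))

    h : ℕ → ℕ
    h r with r ℕ.≤? r0
    ... | yes _ = Y
    ... | no _  = suc (g (ℕ.pred r))

    h-r0 : h r0 ≡ Y
    h-r0 with r0 ℕ.≤? r0
    ... | yes _ = refl
    ... | no r0≰r0 = ⊥-elim (r0≰r0 ℕP.≤-refl)

    h-suc : ∀ r → r0 ℕ.≤ r → h (suc r) ≡ suc (g r)
    h-suc r r0≤r with suc r ℕ.≤? r0
    ... | yes sr≤r0 = ⊥-elim (ℕP.<⇒≱ sr≤r0 r0≤r)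
    ... | no _      = refl

    g<h : ∀ r → r0 ℕ.≤ r → g r ℕ.< h r
    g<h r r0≤r with ℕP.m≤n⇒m<n∨m≡n r0≤r
    ... | inj₂ refl = subst (g r0 ℕ.<_) (sym h-r0) g<Y
    g<h (suc r) _ | inj₁ (s≤s r0≤r) = subst (g (suc r) ℕ.<_) (sym (h-suc r r0≤r)) (s≤s (row-suc≤ λ' r))

    f : ℕ → ℕ
    f = splice g h r0 r1

    f↓ : Decreasing f
    f↓ = splice-decreasing g h r0 r1 r0≤r1 (row-suc≤ λ')
           (λ r r0≤r _ → subst (ℕ._≤ h r) (sym (h-suc r r0≤r)) (g<h r r0≤r))
           (λ p sp≡r0 → subst (ℕ._≤ g p) (sym h-r0) (Y≤above p sp≡r0))
           (ℕP.≤-trans (row-suc≤ λ' r1) (ℕP.<⇒≤ (g<h r1 r0≤r1)))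

    f-vanishes : f (suc r1 ℕ.+ length (parts λ')) ≡ 0
    f-vanishes = trans (splice-below g h r0 r1 _ (s≤s (ℕP.m≤m+n r1 _))) (rows-vanish-beyond λ' r1)

    μ : Partition
    μ = fromRows f _ f↓ f-vanishes

    row-μ : ∀ r → row μ r ≡ f r
    row-μ = row-fromRows f _ f↓ f-vanishes

    ribbonRows : RibbonRows μ λ' r0 r1
    ribbonRows = record
      { r0≤r1 = r0≤r1
      ; above = λ r r<r0 → trans (row-μ r) (splice-above g h r0 r1 r r<r0)
      ; below = λ r r1<r → trans (row-μ r) (splice-below g h r0 r1 r r1<r)
      ; shifted = λ r r0≤r r<r1 → trans (row-μ (suc r))
          (trans (splice-inside g h r0 r1 (suc r) (ℕP.m≤n⇒m≤1+n r0≤r) r<r1) (h-suc r r0≤r))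
      ; top = subst (g r0 ℕ.<_) (sym (trans (row-μ r0) (splice-inside g h r0 r1 r0 ℕP.≤-refl r0≤r1)))
                (g<h r0 ℕP.≤-refl) }

    β-top : β μ r0 ≡ y
    β-top = trans (cong (λ z → + z ℤ.- + r0) (trans (row-μ r0)
                    (trans (splice-inside g h r0 r1 r0 ℕP.≤-refl r0≤r1) h-r0)))
                  (trans (cong (ℤ._- + r0) +Y≡) (plus-minus y (+ r0)))

  beadMove : ∃[ μ ] ∃[ s ] BeadMove n μ λ' y s
  beadMove = μ , r1 ℕ.∸ r0 , record
    { r0 = r0 ; r1 = r1 ; rows = ribbonRows ; β-top = β-top ; β-bottom = bead⇒β bead ; spin = refl }

-- ν is λ' with the bead at y moved down to y - n.
module RemoveBead (n : ℕ) (λ' : Partition) (y : ℤ) (bead : Bead λ' y) (gap : Gap λ' (y ℤ.- + n)) where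

  private
    g : ℕ → ℕ
    g = row λ'
    w : ℤ
    w = y ℤ.- + n
    r0 q : ℕ
    r0 = beadsFrom λ' (ℤ.suc y)
    q = beadsFrom λ' (ℤ.suc w)

    sr0≤q : suc r0 ℕ.≤ q
    sr0≤q = subst₂ ℕ._≤_ bead gap (beadsFrom-antitone λ' (ℤP.i-j≤i y (+ n)))

    r1 : ℕ
    r1 = ℕ.pred q

    suc-r1 : suc r1 ≡ q
    suc-r1 = ℕP.suc-pred q {{ℕ.>-nonZero (ℕP.≤-trans (s≤s z≤n) sr0≤q)}}

    r0≤r1 : r0 ℕ.≤ r1
    r0≤r1 = ℕP.≤-pred (subst (suc r0 ℕ.≤_) (sym suc-r1) sr0≤q)

    w+r1<g : ℤ.suc w ℤ.+ + r1 ℤ.≤ + g r1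
    w+r1<g = ≤β⇒≤row λ' r1 (≤β-beforeBeadsFrom λ' (ℤ.suc w) r1 (subst (r1 ℕ.<_) suc-r1 ℕP.≤-refl))

    g≤w+r1 : + g (suc r1) ℤ.≤ w ℤ.+ + r1
    g≤w+r1 = <suc⇒≤ (subst (+ g (suc r1) ℤ.<_) (swap w (+ r1))
                (β<⇒row< λ' (suc r1) (subst (λ r → β λ' r ℤ.< w) (sym suc-r1) (gap⇒β< gap))))
      where
      swap : ∀ w r → w ℤ.+ (1ℤ ℤ.+ r) ≡ 1ℤ ℤ.+ (w ℤ.+ r)
      swap = solve-∀

    Z : ℕ
    Z = ℤ.∣ w ℤ.+ + r1 ∣

    +Z≡ : + Z ≡ w ℤ.+ + r1
    +Z≡ = ℤP.0≤i⇒+∣i∣≡i (ℤP.≤-trans (ℤ.+≤+ z≤n) g≤w+r1)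

    Z<g : Z ℕ.< g r1
    Z<g = ℤP.drop‿+≤+ (subst (ℤ._≤ + g r1) (trans (ℤP.+-assoc 1ℤ w (+ r1)) (cong ℤ.suc (sym +Z≡))) w+r1<g)

    g≤Z : g (suc r1) ℕ.≤ Z
    g≤Z = ℤP.drop‿+≤+ (subst (+ g (suc r1) ℤ.≤_) (sym +Z≡) g≤w+r1)

    h : ℕ → ℕ
    h r with r1 ℕ.≤? r
    ... | yes _ = Z
    ... | no _  = ℕ.pred (g (suc r))

    h-r1 : h r1 ≡ Z
    h-r1 with r1 ℕ.≤? r1
    ... | yes _    = refl
    ... | no r1≰r1 = ⊥-elim (r1≰r1 ℕP.≤-refl)

    h-above : ∀ r → r ℕ.< r1 → h r ≡ ℕ.pred (g (suc r))
    h-above r r<r1 with r1 ℕ.≤? r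
    ... | yes r1≤r = ⊥-elim (ℕP.<⇒≱ r<r1 r1≤r)
    ... | no _     = refl

    g-suc-positive : ∀ r → r ℕ.< r1 → 0 ℕ.< g (suc r)
    g-suc-positive r r<r1 = ℕP.≤-<-trans z≤n (ℕP.<-≤-trans Z<g (row-antitone λ' r<r1))

    h<g : ∀ r → r ℕ.≤ r1 → h r ℕ.< g r
    h<g r r≤r1 with ℕP.m≤n⇒m<n∨m≡n r≤r1
    ... | inj₂ refl = subst (ℕ._< g r1) (sym h-r1) Z<g
    ... | inj₁ r<r1 = subst (ℕ._< g r) (sym (h-above r r<r1))
                        (ℕP.<-≤-trans pred<g (row-suc≤ λ' r))
      where
      pred<g : ℕ.pred (g (suc r)) ℕ.< g (suc r)
      pred<g = ℕP.m≤pred[n]⇒suc[m]≤n {{ℕ.>-nonZero (g-suc-positive r r<r1)}} ℕP.≤-refl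

    f : ℕ → ℕ
    f = splice g h r0 r1

    f↓ : Decreasing f
    f↓ = splice-decreasing g h r0 r1 r0≤r1 (row-suc≤ λ')
           (λ r _ r<r1 → subst (h (suc r) ℕ.≤_) (sym (h-above r r<r1)) (ℕP.<⇒≤pred (h<g (suc r) r<r1)))
           (λ p sp≡r0 → ℕP.<⇒≤ (ℕP.<-≤-trans (h<g r0 r0≤r1) (row-antitone λ' (subst (p ℕ.≤_) sp≡r0 (ℕP.n≤1+n p)))))
           (subst (g (suc r1) ℕ.≤_) (sym h-r1) g≤Z)

    f-vanishes : f (suc r1 ℕ.+ length (parts λ')) ≡ 0
    f-vanishes = trans (splice-below g h r0 r1 _ (s≤s (ℕP.m≤m+n r1 _))) (rows-vanish-beyond λ' r1)

    ν : Partition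
    ν = fromRows f _ f↓ f-vanishes

    row-ν : ∀ r → row ν r ≡ f r
    row-ν = row-fromRows f _ f↓ f-vanishes

    ribbonRows : RibbonRows λ' ν r0 r1
    ribbonRows = record
      { r0≤r1 = r0≤r1
      ; above = λ r r<r0 → sym (trans (row-ν r) (splice-above g h r0 r1 r r<r0))
      ; below = λ r r1<r → sym (trans (row-ν r) (splice-below g h r0 r1 r r1<r))
      ; shifted = λ r r0≤r r<r1 → trans (sym (ℕP.suc-pred (g (suc r)) {{ℕ.>-nonZero (g-suc-positive r r<r1)}}))
          (cong suc (sym (trans (row-ν r) (trans (splice-inside g h r0 r1 r r0≤r (ℕP.<⇒≤ r<r1)) (h-above r r<r1)))))
      ; top = subst (ℕ._< g r0) (sym (trans (row-ν r0) (splice-inside g h r0 r1 r0 ℕP.≤-refl r0≤r1)))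
                (h<g r0 r0≤r1) }

    β-bottom : β ν r1 ≡ w
    β-bottom = trans (cong (λ z → + z ℤ.- + r1) (trans (row-ν r1)
                       (trans (splice-inside g h r0 r1 r1 r0≤r1 ℕP.≤-refl) h-r1)))
                     (trans (cong (ℤ._- + r1) +Z≡) (plus-minus w (+ r1)))

  beadMove : ∃[ ν ] ∃[ s ] BeadMove n λ' ν y s
  beadMove = ν , r1 ℕ.∸ r0 , record
    { r0 = r0 ; r1 = r1 ; rows = ribbonRows ; β-top = bead⇒β bead ; β-bottom = β-bottom ; spin = refl }

addRibbon⇒beads : ∀ {n λ' μ k s} → AddRibbon n λ' μ k s →
                  Gap λ' (ℤ.suc k) × Bead λ' (ℤ.suc k ℤ.- + n) × beadsIn λ' n (ℤ.suc (ℤ.suc k)) ≡ s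
addRibbon⇒beads {n} {λ'} {μ} add = beadMove-inner (ribbon⇒beadMove {n} {λ'} {μ} add)

-- RemRibbon n λ' ν k s unfolds to AddRibbon n ν λ' k s.
remRibbon⇒beads : ∀ {n λ' ν k s} → 1 ℕ.≤ n → RemRibbon n λ' ν k s →
                  Bead λ' (ℤ.suc k) × Gap λ' (ℤ.suc k ℤ.- + n) × beadsIn λ' n (ℤ.suc k) ≡ s
remRibbon⇒beads {n} {λ'} {ν} 1≤n rem = beadMove-outer (ribbon⇒beadMove {n} {ν} {λ'} rem) 1≤n

gap-bead⇒addRibbon : ∀ {n λ' k} → Gap λ' (ℤ.suc k) → Bead λ' (ℤ.suc k ℤ.- + n) → ∃[ μ ] ∃[ s ] AddRibbon n λ' μ k s
gap-bead⇒addRibbon {n} {λ'} {k} gap bead =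
  let μ , s , move = AddBead.beadMove n λ' (ℤ.suc k) gap bead in μ , s , beadMove⇒ribbon move

bead-gap⇒remRibbon : ∀ {n λ' k} → Bead λ' (ℤ.suc k) → Gap λ' (ℤ.suc k ℤ.- + n) → ∃[ ν ] ∃[ s ] RemRibbon n λ' ν k s
bead-gap⇒remRibbon {n} {λ'} {k} bead gap =
  let ν , s , move = RemoveBead.beadMove n λ' (ℤ.suc k) bead gap in ν , s , beadMove⇒ribbon move

-- The eigenvalues of h_k^{(j)} and their sums

Δ : ℕ → ℕ → ℕ → Poly
Δ j a b = geom j a +ₚ (-ₚ geom j b)

module _ (j : ℕ) where

  private
    exponent-comm : ∀ s → 2 ℕ.* j ℕ.* s ≡ 2 ℕ.* s ℕ.* j
    exponent-comm s = comm j s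
      where
      comm : ∀ j s → 2 ℕ.* j ℕ.* s ≡ 2 ℕ.* s ℕ.* j
      comm = ℕ-Solver.solve-∀

  Δ-suc-right : ∀ s → (-ₚ qpow (2 ℕ.* j ℕ.* s)) ≈ Δ j s (suc s)
  Δ-suc-right s m rewrite exponent-comm s = cancel (geom j s m) (qpow (2 ℕ.* s ℕ.* j) m)
    where
    cancel : ∀ g x → ℤ.- x ≡ g ℤ.+ ℤ.- (g ℤ.+ x)
    cancel = solve-∀

  Δ-suc-left : ∀ s → qpow (2 ℕ.* j ℕ.* s) ≈ Δ j (suc s) s
  Δ-suc-left s m rewrite exponent-comm s = cancel (geom j s m) (qpow (2 ℕ.* s ℕ.* j) m)
    where
    cancel : ∀ g x → x ≡ (g ℤ.+ x) ℤ.+ ℤ.- g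
    cancel = solve-∀

  Δ-self : ∀ a → 0ₚ ≈ Δ j a a
  Δ-self a m = sym (ℤP.+-inverseʳ (geom j a m))

  Δ-trans : ∀ a b c → (Δ j b a +ₚ Δ j c b) ≈ Δ j c a
  Δ-trans a b c m = telescope (geom j a m) (geom j b m) (geom j c m)
    where
    telescope : ∀ x y z → (y ℤ.+ ℤ.- x) ℤ.+ (z ℤ.+ ℤ.- y) ≡ z ℤ.+ ℤ.- x
    telescope = solve-∀

≈-trans : ∀ {f g h} → f ≈ g → g ≈ h → f ≈ h
≈-trans f≈g g≈h m = trans (f≈g m) (g≈h m)

hActs⇒Δ : ∀ {n j k λ' e} → 1 ℕ.≤ n → HActs n j k λ' e →
          e ≈ Δ j (beadsIn λ' n (ℤ.suc (ℤ.suc k))) (beadsIn λ' n (ℤ.suc k))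
hActs⇒Δ {n} {j} {k} {λ'} {e} 1≤n (onAdd , onRemove , otherwise)
  with gap⊎bead λ' (ℤ.suc k) | gap⊎bead λ' (ℤ.suc k ℤ.- + n)
... | inj₁ gap | inj₂ bead = addable (gap-bead⇒addRibbon {n} gap bead)
  where
  addable : ∃[ μ ] ∃[ s ] AddRibbon n λ' μ k s → e ≈ Δ j (beadsIn λ' n (ℤ.suc (ℤ.suc k))) (beadsIn λ' n (ℤ.suc k))
  addable (μ , s , add) = ≈-trans (onAdd μ s add)
    (subst₂ (λ a b → (-ₚ qpow (2 ℕ.* j ℕ.* s)) ≈ Δ j a b) (sym count)
            (sym (trans (beadsIn-gap-bead λ' n (ℤ.suc k) gap bead) (cong suc count))) (Δ-suc-right j s))
    where
    count : beadsIn λ' n (ℤ.suc (ℤ.suc k)) ≡ s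
    count = proj₂ (proj₂ (addRibbon⇒beads {n} {λ'} {μ} add))
... | inj₂ bead | inj₁ gap = removable (bead-gap⇒remRibbon {n} bead gap)
  where
  removable : ∃[ ν ] ∃[ s ] RemRibbon n λ' ν k s → e ≈ Δ j (beadsIn λ' n (ℤ.suc (ℤ.suc k))) (beadsIn λ' n (ℤ.suc k))
  removable (ν , s , rem) = ≈-trans (onRemove ν s rem)
    (subst₂ (λ a b → qpow (2 ℕ.* j ℕ.* s) ≈ Δ j a b)
            (sym (trans (beadsIn-bead-gap λ' n (ℤ.suc k) bead gap) (cong suc count))) (sym count) (Δ-suc-left j s))
    where
    count : beadsIn λ' n (ℤ.suc k) ≡ s
    count = proj₂ (proj₂ (remRibbon⇒beads {n} {λ'} {ν} 1≤n rem))
... | inj₁ gap | inj₁ gap-n = ≈-trans (otherwise noAdd noRemove)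
  (subst (λ a → 0ₚ ≈ Δ j a (beadsIn λ' n (ℤ.suc k))) (sym (beadsIn-gap-gap λ' n (ℤ.suc k) gap gap-n))
         (Δ-self j (beadsIn λ' n (ℤ.suc k))))
  where
  noAdd : ∀ μ s → ¬ AddRibbon n λ' μ k s
  noAdd μ s add = gap-bead-exclusive gap-n (proj₁ (proj₂ (addRibbon⇒beads {n} {λ'} {μ} add)))
  noRemove : ∀ ν s → ¬ RemRibbon n λ' ν k s
  noRemove ν s rem = gap-bead-exclusive gap (proj₁ (remRibbon⇒beads {n} {λ'} {ν} 1≤n rem))
... | inj₂ bead | inj₂ bead-n = ≈-trans (otherwise noAdd noRemove)
  (subst (λ a → 0ₚ ≈ Δ j a (beadsIn λ' n (ℤ.suc k))) (sym (beadsIn-bead-bead λ' n (ℤ.suc k) bead bead-n))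
         (Δ-self j (beadsIn λ' n (ℤ.suc k))))
  where
  noAdd : ∀ μ s → ¬ AddRibbon n λ' μ k s
  noAdd μ s add = gap-bead-exclusive (proj₁ (addRibbon⇒beads {n} {λ'} {μ} add)) bead
  noRemove : ∀ ν s → ¬ RemRibbon n λ' ν k s
  noRemove ν s rem = gap-bead-exclusive (proj₁ (proj₂ (remRibbon⇒beads {n} {λ'} {ν} 1≤n rem))) bead-n

sumFrom-telescopes : ∀ {n j λ'} → 1 ℕ.≤ n → ∀ (e : ℤ → Poly) m a → (∀ k → a ℤ.≤ k → HActs n j k λ' (e k)) →
  sumFrom a m e ≈ Δ j (beadsIn λ' n (ℤ.suc (a ℤ.+ + m))) (beadsIn λ' n (ℤ.suc a))
sumFrom-telescopes {n} {j} {λ'} 1≤n e zero a acts rewrite ℤP.+-identityʳ a = Δ-self j (beadsIn λ' n (ℤ.suc a))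
sumFrom-telescopes {n} {j} {λ'} 1≤n e (suc m) a acts t = begin
  e a t ℤ.+ sumFrom (ℤ.suc a) m e t
    ≡⟨ cong₂ ℤ._+_ (hActs⇒Δ 1≤n (acts a ℤP.≤-refl) t)
                   (sumFrom-telescopes 1≤n e m (ℤ.suc a) (λ k a<k → acts k (ℤP.≤-trans (ℤP.i≤suc[i] a) a<k)) t) ⟩
  (Δ j (W (ℤ.suc a)) (W a) +ₚ Δ j (W (ℤ.suc a ℤ.+ + m)) (W (ℤ.suc a))) t
    ≡⟨ Δ-trans j (W a) (W (ℤ.suc a)) (W (ℤ.suc a ℤ.+ + m)) t ⟩
  Δ j (W (ℤ.suc a ℤ.+ + m)) (W a) t
    ≡⟨ cong (λ z → Δ j (W z) (W a) t) (swap a (+ m)) ⟩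
  Δ j (W (a ℤ.+ + suc m)) (W a) t ∎
  where
  open ≡-Reasoning
  W : ℤ → ℕ
  W k = beadsIn λ' n (ℤ.suc k)
  swap : ∀ a m → (1ℤ ℤ.+ a) ℤ.+ m ≡ a ℤ.+ (1ℤ ℤ.+ m)
  swap = solve-∀

beadsIn-eventually-0 : ∀ λ' n a → ∃[ N ] (∀ m → N ℕ.≤ m → beadsIn λ' n (ℤ.suc (a ℤ.+ + m)) ≡ 0)
beadsIn-eventually-0 λ' n a = ℤ.∣ R ℤ.- a ∣ , λ m N≤m →
  trans (cong (ℕ._∸ beadsFrom λ' (ℤ.suc (a ℤ.+ + m))) (beadsFrom-unique λ' _ 0 (λ _ ()) (β0< m N≤m)))
        (ℕP.0∸n≡0 (beadsFrom λ' (ℤ.suc (a ℤ.+ + m))))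
  where
  R : ℤ
  R = + row λ' 0 ℤ.+ + n
  β0< : ∀ m → ℤ.∣ R ℤ.- a ∣ ℕ.≤ m → β λ' 0 ℤ.< ℤ.suc (a ℤ.+ + m) ℤ.- + n
  β0< m N≤m = subst (ℤ._< ℤ.suc (a ℤ.+ + m) ℤ.- + n) (sym (ℤP.+-identityʳ (+ row λ' 0)))
    (ℤP.<-≤-trans (subst (+ row λ' 0 ℤ.<_) (sym (regroup (+ row λ' 0) (+ n))) (i<suc[i] _))
                  (ℤP.+-monoˡ-≤ (ℤ.- + n) (ℤP.suc-mono R≤a+m)))
    where
    regroup : ∀ r n → (1ℤ ℤ.+ (r ℤ.+ n)) ℤ.- n ≡ 1ℤ ℤ.+ r
    regroup = solve-∀
    R≤a+m : R ℤ.≤ a ℤ.+ + m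
    R≤a+m = subst (ℤ._≤ a ℤ.+ + m) (a+[R-a]≡R a R)
              (ℤP.+-monoʳ-≤ a (ℤP.≤-trans (i≤+∣i∣ (R ℤ.- a)) (ℤ.+≤+ N≤m)))
      where
      a+[R-a]≡R : ∀ a R → a ℤ.+ (R ℤ.- a) ≡ R
      a+[R-a]≡R = solve-∀

sumActs : ∀ {n} j λ' a {w} → 1 ℕ.≤ n → beadsIn λ' n (ℤ.suc a) ≡ w → SumActs n j a λ' (-ₚ geom j w)
sumActs {n} j λ' a 1≤n refl e acts with beadsIn-eventually-0 λ' n a
... | N , vanish = N , λ m N≤m t →
  trans (sumFrom-telescopes 1≤n e m a acts t)
        (trans (cong (λ z → Δ j z (beadsIn λ' n (ℤ.suc a)) t) (vanish m N≤m)) (ℤP.+-identityˡ _))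

bead-beyond-length : ∀ λ' y → y ℤ.≤ ℤ.- + length (parts λ') → Bead λ' y
bead-beyond-length λ' y y≤-L with position (length (parts λ')) y y≤-L
  where
  position : ∀ L y → y ℤ.≤ ℤ.- + L → ∃[ r ] (L ℕ.≤ r × ℤ.- + r ≡ y)
  position zero    (+ zero)  _            = 0 , z≤n , refl
  position zero    (+ suc _) (ℤ.+≤+ ())
  position zero    -[1+ m ]  _            = suc m , z≤n , refl
  position (suc L) -[1+ m ]  (ℤ.-≤- L≤m) = suc m , s≤s L≤m , refl
... | r , L≤r , -r≡y = bead-atβ λ' r y
  (trans (cong (λ z → + z ℤ.- + r) (partAt-beyond (parts λ') r L≤r)) (trans (ℤP.+-identityˡ _) -r≡y))

module _ {n : ℕ} (1≤n : 1 ℕ.≤ n) (λ' : Partition) (i : ℤ)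
         (noAdd : ∀ k → k ℤ.< i → ∀ μ s → ¬ AddRibbon n λ' μ k s) where

  private
    L : ℕ
    L = length (parts λ')

    beads-upTo : ∀ d y → y ℤ.≤ + d ℤ.- + L → y ℤ.≤ i → Bead λ' y
    beads-upTo zero y y≤-L _ = bead-beyond-length λ' y (subst (y ℤ.≤_) (ℤP.+-identityˡ _) y≤-L)
    beads-upTo (suc d) y y≤ y≤i with gap⊎bead λ' y
    ... | inj₂ bead = bead
    ... | inj₁ gap  = ⊥-elim (notAddable (gap-bead⇒addRibbon {n} (subst (Gap λ') (sym (ℤP.suc-pred y)) gap) bead))
      where
      lower : ∀ d L → ((1ℤ ℤ.+ d) ℤ.- L) ℤ.- 1ℤ ≡ d ℤ.- L
      lower = solve-∀
      y-n≤ : y ℤ.- + n ℤ.≤ + d ℤ.- + L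
      y-n≤ = ℤP.≤-trans (ℤP.+-monoʳ-≤ y (ℤP.neg-mono-≤ (ℤ.+≤+ 1≤n)))
               (subst (y ℤ.- 1ℤ ℤ.≤_) (lower (+ d) (+ L)) (ℤP.+-monoˡ-≤ (ℤ.- 1ℤ) y≤))
      bead : Bead λ' (ℤ.suc (ℤ.pred y) ℤ.- + n)
      bead = subst (λ z → Bead λ' (z ℤ.- + n)) (sym (ℤP.suc-pred y))
               (beads-upTo d (y ℤ.- + n) y-n≤ (ℤP.≤-trans (ℤP.i-j≤i y (+ n)) y≤i))
      notAddable : ¬ (∃[ μ ] ∃[ s ] AddRibbon n λ' μ (ℤ.pred y) s)
      notAddable (μ , s , add) = noAdd (ℤ.pred y) (ℤP.<-≤-trans (ℤP.i≤pred[j]⇒i<j ℤP.≤-refl) y≤i) μ s add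

  noAddable⇒bead : ∀ y → y ℤ.≤ i → Bead λ' y
  noAddable⇒bead y = beads-upTo (ℤ.∣ y ∣ ℕ.+ L) y (subst (y ℤ.≤_) (sym (plus-minus (+ ℤ.∣ y ∣) (+ L))) (i≤+∣i∣ y))

  noAddable⇒beadsFrom : ∀ t → beadsFrom λ' (ℤ.suc i ℤ.- + t) ≡ beadsFrom λ' (ℤ.suc i) ℕ.+ t
  noAddable⇒beadsFrom zero    = trans (cong (beadsFrom λ') (ℤP.+-identityʳ _)) (sym (ℕP.+-identityʳ _))
  noAddable⇒beadsFrom (suc t) = begin
    beadsFrom λ' (ℤ.suc i ℤ.- + suc t)         ≡⟨ cong (beadsFrom λ') (cancel-suc i (+ t)) ⟩
    beadsFrom λ' (i ℤ.- + t)                   ≡⟨ noAddable⇒bead (i ℤ.- + t) (ℤP.i-j≤i i (+ t)) ⟩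
    suc (beadsFrom λ' (ℤ.suc (i ℤ.- + t)))     ≡⟨ cong (λ z → suc (beadsFrom λ' z)) (sym (suc-minus i t)) ⟩
    suc (beadsFrom λ' (ℤ.suc i ℤ.- + t))       ≡⟨ cong suc (noAddable⇒beadsFrom t) ⟩
    suc (beadsFrom λ' (ℤ.suc i) ℕ.+ t)         ≡⟨ sym (ℕP.+-suc _ t) ⟩
    beadsFrom λ' (ℤ.suc i) ℕ.+ suc t           ∎
    where
    open ≡-Reasoning
    cancel-suc : ∀ i t → (1ℤ ℤ.+ i) ℤ.- (1ℤ ℤ.+ t) ≡ i ℤ.- t
    cancel-suc = solve-∀

  noAddable⇒beadsIn≡n : beadsIn λ' n (ℤ.suc i) ≡ n
  noAddable⇒beadsIn≡n =
    trans (cong (ℕ._∸ beadsFrom λ' (ℤ.suc i)) (noAddable⇒beadsFrom n)) (ℕP.m+n∸m≡n (beadsFrom λ' (ℤ.suc i)) n)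

remRibbon⇒beadsIn-suc : ∀ {n λ' ν k s} → 1 ℕ.≤ n → RemRibbon n λ' ν k s → beadsIn λ' n (ℤ.suc (ℤ.suc k)) ≡ suc s
remRibbon⇒beadsIn-suc {n} {λ'} {ν} {k} {s} 1≤n rem = shift (remRibbon⇒beads {n} {λ'} {ν} 1≤n rem)
  where
  shift : Bead λ' (ℤ.suc k) × Gap λ' (ℤ.suc k ℤ.- + n) × beadsIn λ' n (ℤ.suc k) ≡ s →
          beadsIn λ' n (ℤ.suc (ℤ.suc k)) ≡ suc s
  shift (bead , gap , count) = trans (beadsIn-bead-gap λ' n (ℤ.suc k) bead gap) (cong suc count)

lemma5p6 : (n : ℕ) → 1 ℕ.≤ n → (λ' : Partition) → (i : ℤ) → (j : ℕ) → 1 ℕ.≤ j →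
    ((μ : Partition) (s : ℕ) → AddRibbon n λ' μ i s →
      SumActs n j (ℤ.suc i) λ' (-ₚ geom j s))
    × ((ν : Partition) (s : ℕ) → RemRibbon n λ' ν i s →
      SumActs n j (ℤ.suc i) λ' (-ₚ geom j (ℕ.suc s)))
    × ((∀ k → k ℤ.< i → ∀ μ s → ¬ AddRibbon n λ' μ k s) →
      SumActs n j i λ' (-ₚ geom j n))
lemma5p6 n 1≤n λ' i j _ =
  (λ μ s add → sumActs j λ' (ℤ.suc i) 1≤n (proj₂ (proj₂ (addRibbon⇒beads {n} {λ'} {μ} add)))) ,
  (λ ν s rem → sumActs j λ' (ℤ.suc i) 1≤n (remRibbon⇒beadsIn-suc {n} {λ'} {ν} 1≤n rem)) ,
  (λ noAdd → sumActs j λ' i 1≤n (noAddable⇒beadsIn≡n 1≤n λ' i noAdd))
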